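{- Let $y,z\in I_n$ and $i$ be such that $z=s_iys_i$, $y(i)=i$, and one of the following holds: (1) $y$ has the $2$-cycles $(a,i+1)$ and $(b,i+2)$ with $a<b<i$; (2) $y$ has the $2$-cycles $(a,i+1)$ and $(i+2,b)$ with $a<i<i+2<b$; (3) $y$ has the $2$-cycles $(i+1,a)$ and $(i+2,b)$ with $i+2<a<b$; (4) $y$ has the $2$-cycles $(b,i-1)$ and $(a,i+1)$ with $a<b<i$; (5) $y$ has the $2$-cycles $(a,i+1)$ and $(i-1,b)$ with $a<i<i+2<b$; (6) $y$ has the $2$-cycles $(i+1,a)$ and $(i-1,b)$ with $i+2<a<b$. Then $\lambda^{\mathbf m}_y=\lambda^{\mathbf m}_z$.
   Context: $I_n$ is the set of involutions in $S_n$, $s_i=(i,i+1)$, and a $2$-cycle $(p,q)$ is written with $p<q$ (so in each case $z$ is obtained from $y$ by exchanging the roles of $i$ and $i+1$; in particular $z(i+1)=i+1$). A partially standard tableau is a Young tableau (English convention) with distinct positive integer entries increasing along rows and down columns. For such $T$ and $a$ not in $T$, $T\xleftarrow{\mathsf{RSK}}a$ is Schensted row insertion. Row Beissinger insertion: for $a\le b$, let $(r,c)$ be the box of $T\xleftarrow{\mathsf{RSK}}a$ not in $T$ (row $r$); if $a<b$, $T\xleftarrow{\mathsf{rBS}}(a,b)$ is obtained by appending $b$ to the end of row $r+1$ of $T\xleftarrow{\mathsf{RSK}}a$; if $a=b$, it equals $T\xleftarrow{\mathsf{RSK}}a$. For $w\in I_n$ with $2$-cycles $(a_1,b_1),\dots,(a_k,b_k)$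 ($a_j<b_j$, $b_1<\dots<b_k$) and fixed points $c_1<\dots<c_q$, $P_{\mathsf{rBS}}(w)=\emptyset\xleftarrow{\mathsf{rBS}}(a_1,b_1)\cdots\xleftarrow{\mathsf{rBS}}(a_k,b_k)\xleftarrow{\mathsf{rBS}}(c_1,c_1)\cdots\xleftarrow{\mathsf{rBS}}(c_q,c_q)$, and $\lambda^{\mathbf m}_w$ is its shape. -}

module Defs where

open import Data.Nat using (ℕ; zero; suc; _+_; _∸_; _<_; _≤_; _<ᵇ_; _≡ᵇ_)
open import Data.Nat.Properties using (_≟_)
open import Data.Bool using (Bool; true; false; if_then_else_)
open import Data.Fin using (Fin; toℕ)
open import Data.List using (List; []; _∷_; [_]; _++_; map; length; upTo; foldl)
open import Data.Product using (_×_; _,_; proj₁; proj₂)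
open import Relation.Binary.PropositionalEquality using (_≡_)
open import Relation.Nullary using (yes; no)

-- Permutations of [n] = {1,…,n} are represented as functions Fin n → Fin n,
-- where the Fin index k stands for the integer toℕ k + 1.

IsInvolution : {n : ℕ} → (Fin n → Fin n) → Set
IsInvolution w = ∀ k → w (w k) ≡ k

-- the action of w on integers: for 1 ≤ k ≤ n, app w k = w(k) (1-based);
-- integers outside [n] are mapped to themselves (never used on them below
-- without a range hypothesis)
app : {n : ℕ} → (Fin n → Fin n) → ℕ → ℕ
app {n} w zero = zero
app {n} w (suc k) with k Data.Nat.<? n
... | yes k<n = suc (toℕ (w (Data.Fin.fromℕ< k<n)))
... | no _ = suc k

swap : ℕ → ℕ → ℕ
swap i k with k ≟ i
... | yes _ = suc i
... | no _ with k ≟ suc i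
...   | yes _ = i
...   | no _ = k

HasCycle : {n : ℕ} → (Fin n → Fin n) → ℕ → ℕ → Set
HasCycle {n} w p q = (1 ≤ p) × (p < q) × (q ≤ n) × (app w p ≡ q)

-- Tableaux: list of rows (English convention), entries positive integers

Tableau : Set
Tableau = List (List ℕ)

data Bump : Set where
  none : Bump
  bumped : ℕ → Bump

insertRow : ℕ → List ℕ → List ℕ × Bump
insertRow x [] = (x ∷ [] , none)
insertRow x (y ∷ ys) with x <ᵇ y
... | true = (x ∷ ys , bumped y)
... | false with insertRow x ys
...   | (ys' , r) = (y ∷ ys' , r)

-- T ←RSK x ; also returns the (0-based) row index r of the new box
rsk : Tableau → ℕ → Tableau × ℕ
rsk [] x = ((x ∷ []) ∷ [] , 0)
rsk (row ∷ rows) x with insertRow x row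
... | (row' , none) = (row' ∷ rows , 0)
... | (row' , bumped y) with rsk rows y
...   | (rows' , r) = (row' ∷ rows' , suc r)

appendAt : ℕ → ℕ → Tableau → Tableau
appendAt zero b [] = (b ∷ []) ∷ []
appendAt zero b (row ∷ rows) = (row ++ (b ∷ [])) ∷ rows
appendAt (suc r) b [] = (b ∷ []) ∷ []
appendAt (suc r) b (row ∷ rows) = row ∷ appendAt r b rows

rBS : Tableau → ℕ × ℕ → Tableau
rBS T (a , b) with a ≡ᵇ b
... | true = proj₁ (rsk T a)
... | false with rsk T a
...   | (T' , r) = appendAt (suc r) b T'

-- the 2-cycles (a_j,b_j) of w listed with b_1 < … < b_k, and fixed points
-- c_1 < … < c_q listed as (c,c)
cyclesOf : {n : ℕ} → (Fin n → Fin n) → List (ℕ × ℕ)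
cyclesOf {n} w = go (map suc (upTo n))
  where
  go : List ℕ → List (ℕ × ℕ)
  go [] = []
  go (q ∷ qs) with app w q <ᵇ q
  ... | true = (app w q , q) ∷ go qs
  ... | false = go qs

fixedOf : {n : ℕ} → (Fin n → Fin n) → List (ℕ × ℕ)
fixedOf {n} w = go (map suc (upTo n))
  where
  go : List ℕ → List (ℕ × ℕ)
  go [] = []
  go (c ∷ cs) with app w c ≡ᵇ c
  ... | true = (c , c) ∷ go cs
  ... | false = go cs

P-rBS : {n : ℕ} → (Fin n → Fin n) → Tableau
P-rBS w = foldl rBS [] (cyclesOf w ++ fixedOf w)

shape : Tableau → List ℕ
shape = map length

λm : {n : ℕ} → (Fin n → Fin n) → List ℕ
λm w = shape (P-rBS w)

-- Let T₀ be the tableau obtained from the 2-cycles of y and its fixed points below i.  Since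
-- z = s_i y s_i, the insertion sequence of z is that of y relabelled by s_i, except that the fixed
-- point i becomes i+1; the fixed points above i+1 are common to both.  Relabelling by s_i commutes
-- with insertion as long as i and i+1 are never compared, so P_rBS(y) and P_rBS(z) continue from
-- T₀ ← i and s_i T₀ ← i+1 respectively with the same insertions of large fixed points.  These two
-- tableaux have the same shape in two situations: when i+1 is not in the first row of T₀ (they
-- then differ by s_i), and when the first row of T₀ reads u, i+1, i+2, v with u < i < i+2 < v
-- (below the first row they then differ by s_{i+1}).  In cases (1), (2), (4), (5) the entry i+1
-- closes its 2-cycle and never reaches the first row.  In case (6) it enters the first row with
-- (i+1, a) and is bumped out again when i-1 is inserted.  In case (3) it enters with (i+1, a), and
-- the insertion of (i+2, b) places i+2 directly after it.

module Submission where

open import Defs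
open import Data.Nat using (ℕ; suc; _+_; _∸_; _<_; _≤_)
open import Data.Fin using (Fin)
open import Data.Product using (_×_; ∃₂)
open import Data.Sum using (_⊎_)
open import Relation.Binary.PropositionalEquality using (_≡_)

open import Data.Bool using (true; false; T; if_then_else_)
open import Data.Bool.Properties using (if-float)
open import Data.Fin using (toℕ; fromℕ<)
open import Data.Fin.Properties using (toℕ<n; fromℕ<-toℕ; toℕ-fromℕ<)
open import Data.List using (List; []; _∷_; [_]; _++_; map; foldl; concat; concatMap; upTo)
open import Data.List.Membership.Propositional using (_∈_)
open import Data.List.Membership.Propositional.Properties using (∈-map⁺; ∈-upTo⁺)
open import Data.List.Properties
  using (map-++; map-id-local; map-cong-local; foldl-++; ++-assoc; length-map; concatMap-++)
open import Data.List.Relation.Unary.All as All using (All; []; _∷_)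
open import Data.List.Relation.Unary.All.Properties
  using (++⁺; ++⁻ˡ; ++⁻ʳ; concat⁺; map⁺; applyUpTo⁺₁)
open import Data.List.Relation.Unary.AllPairs using (AllPairs; []; _∷_)
import Data.List.Relation.Unary.AllPairs.Properties as AllPairs
open import Data.List.Relation.Unary.Any using (here; there)
open import Data.Nat using (zero; z≤n; s≤s; s≤s⁻¹; _<ᵇ_; _≡ᵇ_; _<?_)
open import Data.Nat.Properties
open import Data.Product using (_,_; proj₁; proj₂; ∃; map₁)
import Data.Product as Product
open import Data.Sum using (inj₁; inj₂; [_,_]′)
open import Data.Unit using (⊤; tt)
open import Function using (_∘_; id)
open import Function.Definitions using (Injective)
open import Relation.Nullary using (¬_; yes; no; contradiction)
open import Relation.Binary.PropositionalEquality
  using (_≢_; refl; sym; trans; cong; cong₂; subst; subst₂; module ≡-Reasoning)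

<ᵇ-true : ∀ {m n} → m < n → (m <ᵇ n) ≡ true
<ᵇ-true {m} {n} m<n with m <ᵇ n | <⇒<ᵇ m<n
... | true | _ = refl

<ᵇ-false : ∀ {m n} → n ≤ m → (m <ᵇ n) ≡ false
<ᵇ-false {m} {n} n≤m with m <ᵇ n | <ᵇ⇒< m n
... | false | _   = refl
... | true  | m<n = contradiction (m<n tt) (≤⇒≯ n≤m)

<ᵇ-true⁻¹ : ∀ {m n} → (m <ᵇ n) ≡ true → m < n
<ᵇ-true⁻¹ {m} {n} eq = <ᵇ⇒< m n (subst T (sym eq) tt)

<ᵇ-false⁻¹ : ∀ {m n} → (m <ᵇ n) ≡ false → n ≤ m
<ᵇ-false⁻¹ eq = ≮⇒≥ (λ m<n → subst T eq (<⇒<ᵇ m<n))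

<ᵇ-cong : ∀ {m n m′ n′} → (m < n → m′ < n′) → (m′ < n′ → m < n) →
          (m′ <ᵇ n′) ≡ (m <ᵇ n)
<ᵇ-cong {m} {n} to from with m <? n
... | yes m<n = trans (<ᵇ-true (to m<n)) (sym (<ᵇ-true m<n))
... | no  m≮n = trans (<ᵇ-false (≮⇒≥ (m≮n ∘ from))) (sym (<ᵇ-false (≮⇒≥ m≮n)))

≡ᵇ-refl : ∀ m → (m ≡ᵇ m) ≡ true
≡ᵇ-refl m with m ≡ᵇ m | ≡⇒≡ᵇ m m refl
... | true | _ = refl

≡ᵇ-false : ∀ {m n} → m ≢ n → (m ≡ᵇ n) ≡ false
≡ᵇ-false {m} {n} m≢n with m ≡ᵇ n | ≡ᵇ⇒≡ m n
... | false | _   = refl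
... | true  | m≡n = contradiction (m≡n tt) m≢n

≡ᵇ-true⁻¹ : ∀ {m n} → (m ≡ᵇ n) ≡ true → m ≡ n
≡ᵇ-true⁻¹ {m} {n} eq = ≡ᵇ⇒≡ m n (subst T (sym eq) tt)

≡ᵇ-injective : ∀ {f : ℕ → ℕ} → Injective _≡_ _≡_ f → ∀ m n → (f m ≡ᵇ f n) ≡ (m ≡ᵇ n)
≡ᵇ-injective {f} f-inj m n with m ≟ n
... | yes refl = trans (≡ᵇ-refl (f m)) (sym (≡ᵇ-refl m))
... | no  m≢n  = trans (≡ᵇ-false (m≢n ∘ f-inj)) (sym (≡ᵇ-false m≢n))

1+m<n⇒n≢m : ∀ {m n} → suc m < n → n ≢ m
1+m<n⇒n≢m 1+m<n = >⇒≢ (<-trans (n<1+n _) 1+m<n)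

swap-i : ∀ i → swap i i ≡ suc i
swap-i i with i ≟ i
... | yes _   = refl
... | no  i≢i = contradiction refl i≢i

swap-1+i : ∀ i → swap i (suc i) ≡ i
swap-1+i i with suc i ≟ i
... | yes 1+i≡i = contradiction 1+i≡i 1+n≢n
... | no  _ with suc i ≟ suc i
...   | yes _ = refl
...   | no  ne = contradiction refl ne

swap-fix : ∀ {i k} → k ≢ i → k ≢ suc i → swap i k ≡ k
swap-fix {i} {k} k≢i k≢1+i with k ≟ i
... | yes k≡i = contradiction k≡i k≢i
... | no  _ with k ≟ suc i
...   | yes k≡1+i = contradiction k≡1+i k≢1+i
...   | no  _     = refl

swap-fix-< : ∀ {i k} → k < i → swap i k ≡ k
swap-fix-< k<i = swap-fix (<⇒≢ k<i) (<⇒≢ (m<n⇒m<1+n k<i))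

swap-fix-> : ∀ {i k} → suc i < k → swap i k ≡ k
swap-fix-> 1+i<k = swap-fix (1+m<n⇒n≢m 1+i<k) (>⇒≢ 1+i<k)

data SwapCase (i k : ℕ) : Set where
  at-i   : k ≡ i → SwapCase i k
  at-1+i : k ≡ suc i → SwapCase i k
  away   : k ≢ i → k ≢ suc i → SwapCase i k

swapCase : ∀ i k → SwapCase i k
swapCase i k with k ≟ i | k ≟ suc i
... | yes k≡i | _         = at-i k≡i
... | no  _   | yes k≡1+i = at-1+i k≡1+i
... | no  k≢i | no  k≢1+i = away k≢i k≢1+i

swap-involutive : ∀ i k → swap i (swap i k) ≡ k
swap-involutive i k with swapCase i k
... | at-i   refl = trans (cong (swap i) (swap-i i)) (swap-1+i i)
... | at-1+i refl = trans (cong (swap i) (swap-1+i i)) (swap-i i)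
... | away p q    = trans (cong (swap i) (swap-fix p q)) (swap-fix p q)

swap-injective : ∀ i → Injective _≡_ _≡_ (swap i)
swap-injective i {a} {b} eq =
  trans (sym (swap-involutive i a)) (trans (cong (swap i) eq) (swap-involutive i b))

swap-<ᵇ : ∀ i v e → ¬ (v ≡ i × e ≡ suc i) → ¬ (v ≡ suc i × e ≡ i) →
          (swap i v <ᵇ swap i e) ≡ (v <ᵇ e)
swap-<ᵇ i v e ok₁ ok₂ with swapCase i v | swapCase i e
... | at-i refl   | at-i refl   rewrite swap-i i = refl
... | at-i refl   | at-1+i refl = contradiction (refl , refl) ok₁
... | at-i refl   | away p q    rewrite swap-i i | swap-fix p q =
  <ᵇ-cong (λ i<e → ≤∧≢⇒< i<e (q ∘ sym)) (<-trans (n<1+n i))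
... | at-1+i refl | at-i refl   = contradiction (refl , refl) ok₂
... | at-1+i refl | at-1+i refl rewrite swap-1+i i = refl
... | at-1+i refl | away p q    rewrite swap-1+i i | swap-fix p q =
  <ᵇ-cong (<-trans (n<1+n i)) (λ i<e → ≤∧≢⇒< i<e (q ∘ sym))
... | away p q    | at-i refl   rewrite swap-i i | swap-fix p q =
  <ᵇ-cong m<n⇒m<1+n (λ v<1+i → ≤∧≢⇒< (s≤s⁻¹ v<1+i) p)
... | away p q    | at-1+i refl rewrite swap-1+i i | swap-fix p q =
  <ᵇ-cong (λ v<1+i → ≤∧≢⇒< (s≤s⁻¹ v<1+i) p) m<n⇒m<1+n
... | away p q    | away p′ q′  rewrite swap-fix p q | swap-fix p′ q′ = refl

swap-<ᵇ-away : ∀ j {v e} → e ≢ j → e ≢ suc j → (swap j v <ᵇ swap j e) ≡ (v <ᵇ e)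
swap-<ᵇ-away j {v} {e} e≢j e≢1+j = swap-<ᵇ j v e (e≢1+j ∘ proj₂) (e≢j ∘ proj₂)

swap-<ᵇ-above : ∀ j {v e} → suc j < v → (swap j v <ᵇ swap j e) ≡ (v <ᵇ e)
swap-<ᵇ-above j {v} {e} 1+j<v = swap-<ᵇ j v e (1+m<n⇒n≢m 1+j<v ∘ proj₁) (>⇒≢ 1+j<v ∘ proj₁)

swap-<ᵇ-≢ : ∀ j {v e} → v ≢ j → e ≢ j → (swap j v <ᵇ swap j e) ≡ (v <ᵇ e)
swap-<ᵇ-≢ j {v} {e} v≢j e≢j = swap-<ᵇ j v e (v≢j ∘ proj₁) (e≢j ∘ proj₂)

insertRow-< : ∀ {x e} w → x < e → insertRow x (e ∷ w) ≡ (x ∷ w , bumped e)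
insertRow-< {x} {e} w x<e rewrite <ᵇ-true x<e = refl

insertRow-≥ : ∀ {x e w r} → e ≤ x → insertRow x w ≡ r → insertRow x (e ∷ w) ≡ map₁ (e ∷_) r
insertRow-≥ {x} {e} {w} e≤x refl rewrite <ᵇ-false e≤x with insertRow x w
... | _ = refl

insertRow-++ : ∀ {x} u w → All (_≤ x) u → insertRow x (u ++ w) ≡ map₁ (u ++_) (insertRow x w)
insertRow-++ []      w []          = refl
insertRow-++ (e ∷ u) w (e≤x ∷ u≤x) = insertRow-≥ e≤x (insertRow-++ u w u≤x)

insertRow-All : ∀ {P : ℕ → Set} {x} row → All P row → P x → All P (proj₁ (insertRow x row))
insertRow-All []        []         px = px ∷ []
insertRow-All {x = x} (e ∷ row) (pe ∷ prow) px with x <ᵇ e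
... | true  = px ∷ prow
... | false with insertRow x row | insertRow-All row prow px
...   | _ , _ | prow′ = pe ∷ prow′

insertRow-bumped : ∀ {P : ℕ → Set} {x r c} row → All P row →
                   insertRow x row ≡ (r , bumped c) → x < c × P c
insertRow-bumped {x = x} (e ∷ row) (pe ∷ prow) eq with x <ᵇ e in x<ᵇe
insertRow-bumped (e ∷ row) (pe ∷ prow) refl | true = <ᵇ-true⁻¹ x<ᵇe , pe
... | false with insertRow x row in eq′
insertRow-bumped (e ∷ row) (pe ∷ prow) refl | false | _ , bumped _ = insertRow-bumped row prow eq′

[]≢++∷ : ∀ u {x : ℕ} {w} → [] ≢ u ++ x ∷ w
[]≢++∷ []      ()
[]≢++∷ (_ ∷ _) ()

Sorted : List ℕ → Set
Sorted = AllPairs _≤_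

insertRow-Sorted : ∀ {x} row → Sorted row → Sorted (proj₁ (insertRow x row))
insertRow-Sorted []        []            = [] ∷ []
insertRow-Sorted {x} (e ∷ row) (e≤row ∷ s) with x <ᵇ e in x<ᵇe
... | true  = All.map (≤-trans (<⇒≤ (<ᵇ-true⁻¹ x<ᵇe))) e≤row ∷ s
... | false with insertRow x row | insertRow-All {x = x} row e≤row (<ᵇ-false⁻¹ x<ᵇe)
                | insertRow-Sorted {x} row s
...   | _ , _ | e≤row′ | s′ = e≤row′ ∷ s′

Sorted-suffix : ∀ u {c w} → Sorted (u ++ c ∷ w) → All (c ≤_) w
Sorted-suffix []      (c≤w ∷ _) = c≤w
Sorted-suffix (_ ∷ u) (_ ∷ s)   = Sorted-suffix u s

data PivotInsertion (x : ℕ) (u : List ℕ) (p : ℕ) (v : List ℕ) : Set where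
  bumps-prefix : ∀ {u′ c} → insertRow x u ≡ (u′ , bumped c) →
                 insertRow x (u ++ p ∷ v) ≡ (u′ ++ p ∷ v , bumped c) → PivotInsertion x u p v
  bumps-pivot  : x < p → insertRow x (u ++ p ∷ v) ≡ (u ++ x ∷ v , bumped p) → PivotInsertion x u p v
  passes-pivot : p ≤ x → insertRow x (u ++ p ∷ v) ≡ map₁ (λ v′ → u ++ p ∷ v′) (insertRow x v) →
                 PivotInsertion x u p v

pivotInsertion : ∀ x u p v → PivotInsertion x u p v
pivotInsertion x [] p v with x <? p
... | yes x<p = bumps-pivot x<p (insertRow-< v x<p)
... | no  x≮p = passes-pivot (≮⇒≥ x≮p) (insertRow-≥ (≮⇒≥ x≮p) refl)
pivotInsertion x (e ∷ u) p v with x <? e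
... | yes x<e = bumps-prefix (insertRow-< u x<e) (insertRow-< (u ++ p ∷ v) x<e)
... | no  x≮e with pivotInsertion x u p v
...   | bumps-prefix q r  = bumps-prefix (insertRow-≥ (≮⇒≥ x≮e) q) (insertRow-≥ (≮⇒≥ x≮e) r)
...   | bumps-pivot x<p r = bumps-pivot x<p (insertRow-≥ (≮⇒≥ x≮e) r)
...   | passes-pivot p≤x r = passes-pivot p≤x (insertRow-≥ (≮⇒≥ x≮e) r)

bumps-prefix-< : ∀ {m x u u′ c} → All (_< m) u → insertRow x u ≡ (u′ , bumped c) →
                 c < m × All (_< m) u′
bumps-prefix-< {u = u} u<m eq with insertRow-bumped u u<m eq
... | x<c , c<m = c<m , subst (All _) (cong proj₁ eq) (insertRow-All u u<m (<-trans x<c c<m))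

AllT : (ℕ → Set) → Tableau → Set
AllT P = All (All P)

firstRow : Tableau → List ℕ
firstRow []      = []
firstRow (r ∷ _) = r

lowerRows : Tableau → Tableau
lowerRows []       = []
lowerRows (_ ∷ rs) = rs

OnBump : (ℕ → Set) → Bump → Set
OnBump P none       = ⊤
OnBump P (bumped c) = P c

rsk-All : ∀ {P : ℕ → Set} T {x} → AllT P T → P x → AllT P (proj₁ (rsk T x))
rsk-All []           []             px = (px ∷ []) ∷ []
rsk-All (row ∷ rows) {x} (prow ∷ prows) px with insertRow x row in eq | insertRow-All row prow px
... | _ , none     | prow′ = prow′ ∷ prows
... | _ , bumped c | prow′ with rsk rows c | rsk-All rows prows (proj₂ (insertRow-bumped row prow eq))
...   | _ , _ | prows′ = prow′ ∷ prows′

appendAt-All : ∀ {P : ℕ → Set} r {b} T → AllT P T → P b → AllT P (appendAt r b T)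
appendAt-All zero    []         []           pb = (pb ∷ []) ∷ []
appendAt-All zero    (_ ∷ _)    (prow ∷ prs) pb = ++⁺ prow (pb ∷ []) ∷ prs
appendAt-All (suc r) []         []           pb = (pb ∷ []) ∷ []
appendAt-All (suc r) (_ ∷ rows) (prow ∷ prs) pb = prow ∷ appendAt-All r rows prs pb

rBS-All : ∀ {P : ℕ → Set} T {a b} → AllT P T → P a → P b → AllT P (rBS T (a , b))
rBS-All T {a} {b} pT pa pb with a ≡ᵇ b
... | true  = rsk-All T pT pa
... | false with rsk T a | rsk-All T pT pa
...   | T′ , r | pT′ = appendAt-All (suc r) T′ pT′ pb

rsk-firstRow : ∀ T a → ∃₂ λ R r → rsk T a ≡ (proj₁ (insertRow a (firstRow T)) ∷ R , r)
rsk-firstRow []          a = _ , _ , refl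
rsk-firstRow (row ∷ rows) a with insertRow a row
... | _ , none     = _ , _ , refl
... | _ , bumped c with rsk rows c
...   | _ = _ , _ , refl

rBS-firstRow : ∀ T a b {row res} → firstRow T ≡ row → insertRow a row ≡ res →
               firstRow (rBS T (a , b)) ≡ proj₁ res
rBS-firstRow T a b refl refl with a ≡ᵇ b | rsk-firstRow T a
... | true  | _ , _ , eq = cong (firstRow ∘ proj₁) eq
... | false | _ , _ , eq rewrite eq = refl

rsk-lowerRows-All : ∀ {P : ℕ → Set} T a → AllT P (lowerRows T) →
                    OnBump P (proj₂ (insertRow a (firstRow T))) → AllT P (lowerRows (proj₁ (rsk T a)))
rsk-lowerRows-All []          a pR pc = []
rsk-lowerRows-All (row ∷ rows) a pR pc with insertRow a row
... | _ , none     = pR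
... | _ , bumped c with rsk rows c | rsk-All rows pR pc
...   | _ | pR′ = pR′

rBS-lowerRows-All : ∀ {P : ℕ → Set} T a b {row res} → firstRow T ≡ row → insertRow a row ≡ res →
                    AllT P (lowerRows T) → P b → OnBump P (proj₂ res) → AllT P (lowerRows (rBS T (a , b)))
rBS-lowerRows-All T a b refl refl pR pb pc with a ≡ᵇ b | rsk-firstRow T a | rsk-lowerRows-All T a pR pc
... | true  | _ | pR′ = pR′
... | false | R , r , eq | pR′ rewrite eq = appendAt-All r R pR′ pb

rBS-firstRow-All : ∀ {P : ℕ → Set} T a b {row res} → firstRow T ≡ row → insertRow a row ≡ res →
                   All P (proj₁ res) → All P (firstRow (rBS T (a , b)))
rBS-firstRow-All T a b eq r = subst (All _) (sym (rBS-firstRow T a b eq r))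

firstRow-All : ∀ {P : ℕ → Set} T → AllT P T → All P (firstRow T)
firstRow-All []      []      = []
firstRow-All (_ ∷ _) (p ∷ _) = p

lowerRows-All : ∀ {P : ℕ → Set} T → AllT P T → AllT P (lowerRows T)
lowerRows-All []      []       = []
lowerRows-All (_ ∷ _) (_ ∷ ps) = ps

AllT-rows : ∀ {P : ℕ → Set} T → All P (firstRow T) → AllT P (lowerRows T) → AllT P T
AllT-rows []      _    _  = []
AllT-rows (_ ∷ _) prow pR = prow ∷ pR

rsk-bumped : ∀ x row R {row′ c} → insertRow x row ≡ (row′ , bumped c) →
             proj₁ (rsk (row ∷ R) x) ≡ row′ ∷ proj₁ (rsk R c)
rsk-bumped x row R {c = c} eq with insertRow x row | eq
... | _ | refl with rsk R c
...   | _ = refl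

mapT : (ℕ → ℕ) → Tableau → Tableau
mapT f = map (map f)

mapT-fix : ∀ {P : ℕ → Set} {f} → (∀ {e} → P e → f e ≡ e) → ∀ {T} → AllT P T → mapT f T ≡ T
mapT-fix fix pT = map-id-local (All.map (λ prow → map-id-local (All.map fix prow)) pT)

shape-mapT : ∀ f T → shape (mapT f T) ≡ shape T
shape-mapT f []           = refl
shape-mapT f (row ∷ rows) = cong₂ _∷_ (length-map f row) (shape-mapT f rows)

mapBump : (ℕ → ℕ) → Bump → Bump
mapBump f none       = none
mapBump f (bumped c) = bumped (f c)

insertRow-map : ∀ f x row → All (λ e → (f x <ᵇ f e) ≡ (x <ᵇ e)) row →
                insertRow (f x) (map f row) ≡ Product.map (map f) (mapBump f) (insertRow x row)
insertRow-map f x []        []          = refl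
insertRow-map f x (e ∷ row) (fe ∷ frow) rewrite fe with x <ᵇ e
... | true  = refl
... | false with insertRow x row | insertRow-map f x row frow
...   | _ , none     | eq rewrite eq = refl
...   | _ , bumped _ | eq rewrite eq = refl

appendAt-map : ∀ f r b T → appendAt r (f b) (mapT f T) ≡ mapT f (appendAt r b T)
appendAt-map f zero    b []           = refl
appendAt-map f zero    b (row ∷ rows) = cong (_∷ mapT f rows) (sym (map-++ f row [ b ]))
appendAt-map f (suc r) b []           = refl
appendAt-map f (suc r) b (row ∷ rows) = cong (map f row ∷_) (appendAt-map f r b rows)

pairMap : (ℕ → ℕ) → ℕ × ℕ → ℕ × ℕ
pairMap f (a , b) = f a , f b

-- Ins: values that get inserted into a row (including bumped ones); Ent: entries they meet.
module Relabel (f : ℕ → ℕ) (f-injective : Injective _≡_ _≡_ f) {Ins Ent : ℕ → Set}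
  (f-<ᵇ : ∀ v e → Ins v → Ent e → (f v <ᵇ f e) ≡ (v <ᵇ e))
  (bumped-Ins : ∀ {v e} → Ins v → Ent e → v < e → Ins e) where

  rsk-map : ∀ T {x} → Ins x → AllT Ent T → rsk (mapT f T) (f x) ≡ map₁ (mapT f) (rsk T x)
  rsk-map []           ix []             = refl
  rsk-map (row ∷ rows) {x} ix (erow ∷ erows)
    rewrite insertRow-map f x row (All.map (f-<ᵇ x _ ix) erow) with insertRow x row in eq
  ... | _ , none     = refl
  ... | _ , bumped c with insertRow-bumped row erow eq
  ...   | x<c , ec rewrite rsk-map rows (bumped-Ins ix ec x<c) erows with rsk rows c
  ...     | _ = refl

  rBS-map : ∀ T {a b} → Ins a → Ent a → Ent b → AllT Ent T →
            rBS (mapT f T) (f a , f b) ≡ mapT f (rBS T (a , b))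
  rBS-map T {a} {b} ia ea eb eT rewrite ≡ᵇ-injective f-injective a b with a ≡ᵇ b
  ... | true  = cong proj₁ (rsk-map T ia eT)
  ... | false rewrite rsk-map T ia eT with rsk T a
  ...   | T′ , r = appendAt-map f (suc r) b T′

  Relabelable : ℕ × ℕ → Set
  Relabelable (a , b) = Ins a × Ent a × Ent b

  foldl-rBS-map : ∀ T L → All Relabelable L → AllT Ent T →
                  foldl rBS (mapT f T) (map (pairMap f) L) ≡ mapT f (foldl rBS T L)
  foldl-rBS-map T []            []                     eT = refl
  foldl-rBS-map T ((a , b) ∷ L) ((ia , ea , eb) ∷ rL) eT
    rewrite rBS-map T ia ea eb eT = foldl-rBS-map (rBS T (a , b)) L rL (rBS-All T eT ea eb)

Above : ℕ → ℕ × ℕ → Set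
Above m (a , b) = m < a × m < b

AllT-⊤ : ∀ T → AllT (λ _ → ⊤) T
AllT-⊤ = All.universal (All.universal (λ _ → tt))

module SwapAbove (j : ℕ) = Relabel (swap j) (swap-injective j) {Ins = suc j <_} {Ent = λ _ → ⊤}
  (λ v e 1+j<v _ → swap-<ᵇ-above j {v} {e} 1+j<v)
  (λ 1+j<v _ v<e → <-trans 1+j<v v<e)

shape-foldl-swap : ∀ j T Qs → All (Above (suc j)) Qs →
                   shape (foldl rBS (mapT (swap j) T) Qs) ≡ shape (foldl rBS T Qs)
shape-foldl-swap j T Qs above = begin
  shape (foldl rBS (mapT (swap j) T) Qs)
    ≡⟨ cong (shape ∘ foldl rBS (mapT (swap j) T)) (sym (map-id-local (All.map fixed above))) ⟩
  shape (foldl rBS (mapT (swap j) T) (map (pairMap (swap j)) Qs))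
    ≡⟨ cong shape (SwapAbove.foldl-rBS-map j T Qs (All.map relabelable above) (AllT-⊤ T)) ⟩
  shape (mapT (swap j) (foldl rBS T Qs))
    ≡⟨ shape-mapT (swap j) _ ⟩
  shape (foldl rBS T Qs) ∎
  where
  open ≡-Reasoning
  fixed : ∀ {o} → Above (suc j) o → pairMap (swap j) o ≡ o
  fixed {_ , _} (j<a , j<b) = cong₂ _,_ (swap-fix-> j<a) (swap-fix-> j<b)
  relabelable : ∀ {o} → Above (suc j) o → SwapAbove.Relabelable j o
  relabelable {_ , _} (j<a , _) = j<a , tt , tt

-- Inserting i into T versus i+1 into s_i T

Avoids : ℕ → ℕ → ℕ → Set
Avoids i e x = x ≢ i × x ≢ suc i × x ≢ e

Avoids-above : ∀ {i e x} → suc i < x → e < x → Avoids i e x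
Avoids-above 1+i<x e<x = 1+m<n⇒n≢m 1+i<x , >⇒≢ 1+i<x , >⇒≢ e<x

PairAvoids : ℕ → ℕ → ℕ × ℕ → Set
PairAvoids i e (a , b) = Avoids i e a × Avoids i e b

Unpivoted : ℕ → Tableau → Set
Unpivoted i T = AllT (_≢ i) T × All (_≢ suc i) (firstRow T)

Pivoted : ℕ → Tableau → Set
Pivoted i T = ∃₂ λ u v → firstRow T ≡ u ++ suc i ∷ suc (suc i) ∷ v ×
              All (_< i) u × All (suc (suc i) <_) v × AllT (Avoids i (suc (suc i))) (lowerRows T)

-- The value bumped by i from the first row exceeds i+1, so s_i only matters in that row.
rsk-swap-unpivoted : ∀ i T → Unpivoted i T →
                     rsk (mapT (swap i) T) (suc i) ≡ map₁ (mapT (swap i)) (rsk T i)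
rsk-swap-unpivoted i []           _                   = cong (λ k → (k ∷ []) ∷ [] , 0) (sym (swap-i i))
rsk-swap-unpivoted i (row ∷ rows) (no-i ∷ _ , no-1+i) =
  trans (cong (rsk (mapT (swap i) (row ∷ rows))) (sym (swap-i i))) first-row
  where
  avoid : All (λ e → e ≢ i × e ≢ suc i) row
  avoid = All.zip (no-i , no-1+i)
  first-row : rsk (mapT (swap i) (row ∷ rows)) (swap i i) ≡ map₁ (mapT (swap i)) (rsk (row ∷ rows) i)
  first-row
    rewrite insertRow-map (swap i) i row (All.map (λ (e≢i , e≢1+i) → swap-<ᵇ-away i e≢i e≢1+i) avoid)
    with insertRow i row in eq
  ... | _ , none     = refl
  ... | _ , bumped c with insertRow-bumped row avoid eq
  ...   | i<c , (_ , c≢1+i)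
    rewrite SwapAbove.rsk-map i rows (≤∧≢⇒< i<c (c≢1+i ∘ sym)) (AllT-⊤ rows) with rsk rows c
  ...     | _ = refl

shape-rsk-swap-unpivoted : ∀ i T Qs → Unpivoted i T → All (Above (suc i)) Qs →
  shape (foldl rBS (proj₁ (rsk T i)) Qs) ≡ shape (foldl rBS (proj₁ (rsk (mapT (swap i) T) (suc i))) Qs)
shape-rsk-swap-unpivoted i T Qs unpivoted above = begin
  shape (foldl rBS (proj₁ (rsk T i)) Qs)
    ≡⟨ shape-foldl-swap i _ Qs above ⟨
  shape (foldl rBS (mapT (swap i) (proj₁ (rsk T i))) Qs)
    ≡⟨ cong (λ T′ → shape (foldl rBS (proj₁ T′) Qs)) (rsk-swap-unpivoted i T unpivoted) ⟨
  shape (foldl rBS (proj₁ (rsk (mapT (swap i) T) (suc i))) Qs) ∎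
  where open ≡-Reasoning

NextIns : ℕ → ℕ → Set
NextIns i v = v ≡ suc i ⊎ suc (suc i) < v

NextIns-bumped : ∀ {i v e} → NextIns i v → e ≢ suc (suc i) → v < e → NextIns i e
NextIns-bumped (inj₁ refl)  e≢2+i v<e = inj₂ (≤∧≢⇒< v<e (e≢2+i ∘ sym))
NextIns-bumped (inj₂ 2+i<v) _     v<e = inj₂ (<-trans 2+i<v v<e)

module SwapNext (i : ℕ) = Relabel (swap (suc i)) (swap-injective (suc i))
  {Ins = NextIns i} {Ent = λ e → e ≢ suc i × e ≢ suc (suc i)}
  (λ _ _ _ (e≢1+i , e≢2+i) → swap-<ᵇ-away (suc i) e≢1+i e≢2+i)
  (λ ins (_ , e≢2+i) → NextIns-bumped ins e≢2+i)

-- Inserting i bumps i+1 from the first row, inserting i+1 into s_i T bumps i+2, and below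
-- the first row the two insertions differ by s_{i+1}.
rsk-swap-pivoted : ∀ i T → Pivoted i T →
                   proj₁ (rsk (mapT (swap i) T) (suc i)) ≡ mapT (swap (suc i)) (proj₁ (rsk T i))
rsk-swap-pivoted i [] (u , _ , []≡u++ , _) = contradiction []≡u++ ([]≢++∷ u)
rsk-swap-pivoted i (_ ∷ R) (u , v , refl , u<i , 2+i<v , avoid) = begin
  proj₁ (rsk (mapT (swap i) ((u ++ suc i ∷ suc (suc i) ∷ v) ∷ R)) (suc i))
    ≡⟨ cong (λ T → proj₁ (rsk T (suc i))) swapped ⟩
  proj₁ (rsk ((u ++ i ∷ suc (suc i) ∷ v) ∷ R) (suc i))
    ≡⟨ rsk-bumped (suc i) (u ++ i ∷ suc (suc i) ∷ v) R insert-1+i ⟩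
  (u ++ i ∷ suc i ∷ v) ∷ proj₁ (rsk R (suc (suc i)))
    ≡⟨ cong₂ _∷_ (sym next-row) (cong proj₁ below) ⟩
  mapT (swap (suc i)) ((u ++ i ∷ suc (suc i) ∷ v) ∷ proj₁ (rsk R (suc i)))
    ≡⟨ cong (mapT (swap (suc i))) (rsk-bumped i (u ++ suc i ∷ suc (suc i) ∷ v) R insert-i) ⟨
  mapT (swap (suc i)) (proj₁ (rsk ((u ++ suc i ∷ suc (suc i) ∷ v) ∷ R) i)) ∎
  where
  open ≡-Reasoning
  i<1+i : i < suc i
  i<1+i = n<1+n i
  1+i<v : All (suc i <_) v
  1+i<v = All.map (<-trans (n<1+n (suc i))) 2+i<v
  u<1+i : All (_< suc i) u
  u<1+i = All.map (λ e<i → <-trans e<i i<1+i) u<i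
  swapped : mapT (swap i) ((u ++ suc i ∷ suc (suc i) ∷ v) ∷ R) ≡ (u ++ i ∷ suc (suc i) ∷ v) ∷ R
  swapped = cong₂ _∷_
    (trans (map-++ (swap i) u _)
      (cong₂ _++_ (map-id-local (All.map swap-fix-< u<i))
        (cong₂ _∷_ (swap-1+i i)
          (cong₂ _∷_ (swap-fix-> (n<1+n (suc i))) (map-id-local (All.map swap-fix-> 1+i<v))))))
    (mapT-fix (λ (e≢i , e≢1+i , _) → swap-fix e≢i e≢1+i) avoid)
  next-row : map (swap (suc i)) (u ++ i ∷ suc (suc i) ∷ v) ≡ u ++ i ∷ suc i ∷ v
  next-row = trans (map-++ (swap (suc i)) u _)
    (cong₂ _++_ (map-id-local (All.map swap-fix-< u<1+i))
      (cong₂ _∷_ (swap-fix-< i<1+i) (cong₂ _∷_ (swap-1+i (suc i)) (map-id-local (All.map swap-fix-> 2+i<v)))))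
  insert-i : insertRow i (u ++ suc i ∷ suc (suc i) ∷ v) ≡ (u ++ i ∷ suc (suc i) ∷ v , bumped (suc i))
  insert-i = trans (insertRow-++ u _ (All.map <⇒≤ u<i)) (cong (map₁ (u ++_)) (insertRow-< _ i<1+i))
  insert-1+i : insertRow (suc i) (u ++ i ∷ suc (suc i) ∷ v) ≡ (u ++ i ∷ suc i ∷ v , bumped (suc (suc i)))
  insert-1+i = trans (insertRow-++ u _ (All.map <⇒≤ u<1+i))
    (cong (map₁ (u ++_)) (insertRow-≥ (<⇒≤ i<1+i) (insertRow-< v (n<1+n (suc i)))))
  below : rsk R (suc (suc i)) ≡ map₁ (mapT (swap (suc i))) (rsk R (suc i))
  below = trans (cong₂ rsk (sym (mapT-fix (λ (_ , e≢1+i , e≢2+i) → swap-fix e≢1+i e≢2+i) avoid))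
                           (sym (swap-i (suc i))))
                (SwapNext.rsk-map i R (inj₁ refl) (All.map (All.map proj₂) avoid))

shape-rsk-swap-pivoted : ∀ i T Qs → Pivoted i T → All (Above (suc (suc i))) Qs →
  shape (foldl rBS (proj₁ (rsk T i)) Qs) ≡ shape (foldl rBS (proj₁ (rsk (mapT (swap i) T) (suc i))) Qs)
shape-rsk-swap-pivoted i T Qs pivoted above = begin
  shape (foldl rBS (proj₁ (rsk T i)) Qs)
    ≡⟨ shape-foldl-swap (suc i) _ Qs above ⟨
  shape (foldl rBS (mapT (swap (suc i)) (proj₁ (rsk T i))) Qs)
    ≡⟨ cong (λ T′ → shape (foldl rBS T′ Qs)) (rsk-swap-pivoted i T pivoted) ⟨
  shape (foldl rBS (proj₁ (rsk (mapT (swap i) T) (suc i))) Qs) ∎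
  where open ≡-Reasoning

rBS-Invariant : (ℕ × ℕ → Set) → (Tableau → Set) → Set
rBS-Invariant G I = ∀ T {o} → G o → I T → I (rBS T o)

foldl-rBS-invariant : ∀ {G I} → rBS-Invariant G I → ∀ T L → All G L → I T → I (foldl rBS T L)
foldl-rBS-invariant step T []      []       iT = iT
foldl-rBS-invariant step T (o ∷ L) (g ∷ gs) iT = foldl-rBS-invariant step (rBS T o) L gs (step T g iT)

foldl-rBS-stages : ∀ {G : ℕ × ℕ → Set} {I₁ I₂ I₃ : Tableau → Set} {o₁ o₂} →
  rBS-Invariant G I₁ → (∀ T → I₁ T → I₂ (rBS T o₁)) →
  rBS-Invariant G I₂ → (∀ T → I₂ T → I₃ (rBS T o₂)) →
  rBS-Invariant G I₃ →
  ∀ L₁ L₂ L₃ → All G L₁ → All G L₂ → All G L₃ → I₁ [] →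
  I₃ (foldl rBS [] (L₁ ++ o₁ ∷ L₂ ++ o₂ ∷ L₃))
foldl-rBS-stages {I₃ = I₃} {o₁} step₁ to₂ step₂ to₃ step₃ L₁ L₂ L₃ g₁ g₂ g₃ i₁ =
  subst I₃ (sym (trans (foldl-++ rBS [] L₁ _) (foldl-++ rBS (rBS (foldl rBS [] L₁) o₁) L₂ _)))
    (foldl-rBS-invariant step₃ _ L₃ g₃ (to₃ _ (foldl-rBS-invariant step₂ _ L₂ g₂
      (to₂ _ (foldl-rBS-invariant step₁ [] L₁ g₁ i₁)))))

insertRow-OnBump : ∀ {P : ℕ → Set} {x} row → All (λ e → x < e → P e) row →
                   OnBump P (proj₂ (insertRow x row))
insertRow-OnBump {x = x} row h with insertRow x row in eq
... | _ , none     = tt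
... | _ , bumped c with insertRow-bumped row h eq
...   | x<c , pc = pc x<c

data InsertionView (x : ℕ) (row : List ℕ) : Set where
  appends  : All (_≤ x) row → insertRow x row ≡ (row ++ [ x ] , none) → InsertionView x row
  replaces : ∀ u c w → row ≡ u ++ c ∷ w → All (_≤ x) u → x < c →
             insertRow x row ≡ (u ++ x ∷ w , bumped c) → InsertionView x row

insertionView : ∀ x row → InsertionView x row
insertionView x []        = appends [] refl
insertionView x (e ∷ row) with x <? e
... | yes x<e = replaces [] e row refl [] x<e (insertRow-< row x<e)
... | no  x≮e with insertionView x row
...   | appends row≤x q               = appends (≮⇒≥ x≮e ∷ row≤x) (insertRow-≥ (≮⇒≥ x≮e) q)
...   | replaces u c w refl u≤x x<c q =
  replaces (e ∷ u) c w refl (≮⇒≥ x≮e ∷ u≤x) x<c (insertRow-≥ (≮⇒≥ x≮e) q)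

≤1+n-avoid⇒< : ∀ {x n} → x ≤ suc n → x ≢ n → x ≢ suc n → x < n
≤1+n-avoid⇒< x≤1+n x≢n x≢1+n = ≤∧≢⇒< (s≤s⁻¹ (≤∧≢⇒< x≤1+n x≢1+n)) x≢n

Unpivoted-step : ∀ i → rBS-Invariant (λ (a , b) → a ≢ i × b ≢ i × a ≢ suc i) (Unpivoted i)
Unpivoted-step i T {a , b} (a≢i , b≢i , a≢1+i) (no-i , no-1+i) =
  rBS-All T no-i a≢i b≢i , rBS-firstRow-All T a b refl refl (insertRow-All (firstRow T) no-1+i a≢1+i)

Pivoted-avoids-i : ∀ i T → Pivoted i T → AllT (_≢ i) T
Pivoted-avoids-i i T (u , v , eq , u<i , 2+i<v , lower) = AllT-rows T
  (subst (All _) (sym eq)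
    (++⁺ (All.map <⇒≢ u<i) (1+n≢n ∷ 1+m<n⇒n≢m (n<1+n (suc i)) ∷ All.map ≢i 2+i<v)))
  (All.map (All.map proj₁) lower)
  where
  ≢i : ∀ {e} → suc (suc i) < e → e ≢ i
  ≢i 2+i<e = 1+m<n⇒n≢m (<-trans (n<1+n (suc i)) 2+i<e)

HalfPivoted : ℕ → Tableau → Set
HalfPivoted i T = ∃₂ λ u v → firstRow T ≡ u ++ suc i ∷ v × All (_< i) u × All (suc i <_) v ×
                  AllT (λ x → x ≢ i × x ≢ suc i) (lowerRows T)

HalfPivoted-avoids-i : ∀ i T → HalfPivoted i T → AllT (_≢ i) T
HalfPivoted-avoids-i i T (u , v , eq , u<i , 1+i<v , lower) = AllT-rows T
  (subst (All _) (sym eq) (++⁺ (All.map <⇒≢ u<i) (1+n≢n ∷ All.map 1+m<n⇒n≢m 1+i<v)))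
  (All.map (All.map proj₁) lower)

-- Case (3): the pairs (i+1, a) and (i+2, b), a < b, are inserted in this order.
module Case3 (i : ℕ) where
  below-avoids : ∀ {x} → x < i → Avoids i (suc (suc i)) x
  below-avoids x<i = <⇒≢ x<i , <⇒≢ (m<n⇒m<1+n x<i) , <⇒≢ (m<n⇒m<1+n (m<n⇒m<1+n x<i))

  above-avoids : ∀ {x} → suc (suc i) < x → Avoids i (suc (suc i)) x
  above-avoids 2+i<x = Avoids-above (<-trans (n<1+n (suc i)) 2+i<x) 2+i<x

  Before : Tableau → Set
  Before T = AllT (Avoids i (suc (suc i))) T × Sorted (firstRow T)

  Between : Tableau → Set
  Between T = AllT (_≢ suc (suc i)) T × (Unpivoted i T ⊎ HalfPivoted i T)

  After : Tableau → Set
  After T = Unpivoted i T ⊎ Pivoted i T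

  before-step : rBS-Invariant (PairAvoids i (suc (suc i))) Before
  before-step T {a , b} (ga , gb) (avoid , sorted) =
    rBS-All T avoid ga gb ,
    subst Sorted (sym (rBS-firstRow T a b refl refl)) (insertRow-Sorted (firstRow T) sorted)

  insert-1+i : ∀ {a} → suc (suc i) < a → ∀ T → Before T → Between (rBS T (suc i , a))
  insert-1+i {a} 2+i<a T (avoid , sorted) =
    rBS-All T (All.map (All.map (proj₂ ∘ proj₂)) avoid) (<⇒≢ (n<1+n (suc i))) (>⇒≢ 2+i<a) ,
    inj₂ (half (insertionView (suc i) (firstRow T)))
    where
    a-avoids : a ≢ i × a ≢ suc i
    a-avoids = Product.map₂ proj₁ (above-avoids 2+i<a)
    row-avoids : All (Avoids i (suc (suc i))) (firstRow T)
    row-avoids = firstRow-All T avoid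
    lower-avoids : AllT (λ x → x ≢ i × x ≢ suc i) (lowerRows T)
    lower-avoids = All.map (All.map (Product.map₂ proj₁)) (lowerRows-All T avoid)
    small : ∀ {x} → x ≤ suc i × Avoids i (suc (suc i)) x → x < i
    small (x≤1+i , x≢i , x≢1+i , _) = ≤1+n-avoid⇒< x≤1+i x≢i x≢1+i
    half : InsertionView (suc i) (firstRow T) → HalfPivoted i (rBS T (suc i , a))
    half (appends row≤1+i q) =
      firstRow T , [] , rBS-firstRow T (suc i) a refl q , All.zipWith small (row≤1+i , row-avoids) , [] ,
      rBS-lowerRows-All T (suc i) a refl q lower-avoids a-avoids tt
    half (replaces u c w eq u≤1+i 1+i<c q) with ++⁻ʳ u (subst (All _) eq row-avoids)
    ... | (c≢i , c≢1+i , _) ∷ _ =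
      u , w , rBS-firstRow T (suc i) a refl q ,
      All.zipWith small (u≤1+i , ++⁻ˡ u (subst (All _) eq row-avoids)) ,
      All.map (<-≤-trans 1+i<c) (Sorted-suffix u (subst Sorted eq sorted)) ,
      rBS-lowerRows-All T (suc i) a refl q lower-avoids a-avoids (c≢i , c≢1+i)

  between-step : rBS-Invariant (PairAvoids i (suc (suc i))) Between
  between-step T {a , b} ((a≢i , a≢1+i , a≢2+i) , (b≢i , b≢1+i , b≢2+i)) (no-2+i , state) =
    rBS-All T no-2+i a≢2+i b≢2+i , step state
    where
    step : Unpivoted i T ⊎ HalfPivoted i T → Unpivoted i (rBS T (a , b)) ⊎ HalfPivoted i (rBS T (a , b))
    step (inj₁ unpivoted) = inj₁ (Unpivoted-step i T (a≢i , b≢i , a≢1+i) unpivoted)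
    step (inj₂ half@(u , v , eq , u<i , 1+i<v , lower)) with pivotInsertion a u (suc i) v
    ... | bumps-prefix {u′} q r with bumps-prefix-< u<i q
    ...   | c<i , u′<i =
      inj₂ (u′ , v , rBS-firstRow T a b eq r , u′<i , 1+i<v ,
            rBS-lowerRows-All T a b eq r lower (b≢i , b≢1+i) (<⇒≢ c<i , <⇒≢ (m<n⇒m<1+n c<i)))
    step (inj₂ half@(u , v , eq , u<i , 1+i<v , lower)) | bumps-pivot _ r =
      inj₁ (rBS-All T (HalfPivoted-avoids-i i T half) a≢i b≢i ,
            rBS-firstRow-All T a b eq r
              (++⁺ (All.map (λ x<i → <⇒≢ (m<n⇒m<1+n x<i)) u<i) (a≢1+i ∷ All.map >⇒≢ 1+i<v)))
    step (inj₂ half@(u , v , eq , u<i , 1+i<v , lower)) | passes-pivot 1+i≤a r =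
      inj₂ (u , proj₁ (insertRow a v) , rBS-firstRow T a b eq r , u<i , insertRow-All v 1+i<v 1+i<a ,
            rBS-lowerRows-All T a b eq r lower (b≢i , b≢1+i)
              (insertRow-OnBump v
                (All.map (λ _ a<x → Product.map₂ proj₁ (Avoids-above (<-trans 1+i<a a<x) a<x)) 1+i<v)))
      where
      1+i<a : suc i < a
      1+i<a = ≤∧≢⇒< 1+i≤a (a≢1+i ∘ sym)

  insert-2+i : ∀ {b} → Avoids i (suc (suc i)) b → ∀ T → Between T → After (rBS T (suc (suc i) , b))
  insert-2+i (b≢i , _ , _) T (_ , inj₁ unpivoted) =
    inj₁ (Unpivoted-step i T (1+m<n⇒n≢m (n<1+n (suc i)) , b≢i , 1+n≢n) unpivoted)
  insert-2+i {b} b-avoids T (no-2+i , inj₂ (u , v , eq , u<i , 1+i<v , lower)) =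
    inj₂ (pivot v eq 1+i<v (++⁻ʳ u (subst (All _) eq (firstRow-All T no-2+i))))
    where
    1+i<2+i : suc i < suc (suc i)
    1+i<2+i = n<1+n (suc i)
    passes-1+i : ∀ w → insertRow (suc (suc i)) (u ++ suc i ∷ w) ≡
                       map₁ (λ w′ → u ++ suc i ∷ w′) (insertRow (suc (suc i)) w)
    passes-1+i w = trans (insertRow-++ u _ (All.map (λ x<i → <⇒≤ (<-trans (m<n⇒m<1+n x<i) 1+i<2+i)) u<i))
                         (cong (map₁ (u ++_)) (insertRow-≥ (<⇒≤ 1+i<2+i) refl))
    lower-avoids : AllT (Avoids i (suc (suc i))) (lowerRows T)
    lower-avoids = All.zipWith (All.zipWith (λ ((x≢i , x≢1+i) , x≢2+i) → x≢i , x≢1+i , x≢2+i))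
                               (lower , lowerRows-All T no-2+i)
    pivot : ∀ w → firstRow T ≡ u ++ suc i ∷ w → All (suc i <_) w → All (_≢ suc (suc i)) (suc i ∷ w) →
            Pivoted i (rBS T (suc (suc i) , b))
    pivot [] eq _ _ =
      u , [] , rBS-firstRow T _ b eq (passes-1+i []) , u<i , [] ,
      rBS-lowerRows-All T _ b eq (passes-1+i []) lower-avoids b-avoids tt
    pivot (x ∷ w) eq (1+i<x ∷ 1+i<w) (_ ∷ x≢2+i ∷ w≢2+i) =
      u , w , rBS-firstRow T _ b eq bumps-x , u<i ,
      All.zipWith (λ (1+i<y , y≢2+i) → ≤∧≢⇒< 1+i<y (y≢2+i ∘ sym)) (1+i<w , w≢2+i) ,
      rBS-lowerRows-All T _ b eq bumps-x lower-avoids b-avoids (above-avoids 2+i<x)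
      where
      2+i<x : suc (suc i) < x
      2+i<x = ≤∧≢⇒< 1+i<x (x≢2+i ∘ sym)
      bumps-x : insertRow (suc (suc i)) (u ++ suc i ∷ x ∷ w) ≡ (u ++ suc i ∷ suc (suc i) ∷ w , bumped x)
      bumps-x = trans (passes-1+i (x ∷ w)) (cong (map₁ (λ w′ → u ++ suc i ∷ w′)) (insertRow-< w 2+i<x))

  after-step : rBS-Invariant (PairAvoids i (suc (suc i))) After
  after-step T {a , b} ((a≢i , a≢1+i , _) , (b≢i , _)) (inj₁ unpivoted) =
    inj₁ (Unpivoted-step i T (a≢i , b≢i , a≢1+i) unpivoted)
  after-step T {a , b} ((a≢i , a≢1+i , a≢2+i) , b-avoids) (inj₂ pivoted@(u , v , eq , u<i , 2+i<v , lower))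
    with pivotInsertion a u (suc i) (suc (suc i) ∷ v)
  ... | bumps-prefix {u′} q r with bumps-prefix-< u<i q
  ...   | c<i , u′<i =
    inj₂ (u′ , v , rBS-firstRow T a b eq r , u′<i , 2+i<v ,
          rBS-lowerRows-All T a b eq r lower b-avoids (below-avoids c<i))
  after-step T {a , b} ((a≢i , a≢1+i , a≢2+i) , (b≢i , _)) (inj₂ pivoted@(u , v , eq , u<i , 2+i<v , lower))
    | bumps-pivot _ r =
    inj₁ (rBS-All T (Pivoted-avoids-i i T pivoted) a≢i b≢i ,
          rBS-firstRow-All T a b eq r
            (++⁺ (All.map (proj₁ ∘ proj₂ ∘ below-avoids) u<i)
                 (a≢1+i ∷ 1+n≢n ∷ All.map (proj₁ ∘ proj₂ ∘ above-avoids) 2+i<v)))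
  after-step T {a , b} ((a≢i , a≢1+i , a≢2+i) , b-avoids) (inj₂ pivoted@(u , v , eq , u<i , 2+i<v , lower))
    | passes-pivot 1+i≤a r =
    inj₂ (u , proj₁ (insertRow a v) , rBS-firstRow T a b eq passes , u<i , insertRow-All v 2+i<v 2+i<a ,
          rBS-lowerRows-All T a b eq passes lower b-avoids
            (insertRow-OnBump v (All.map (λ _ a<x → above-avoids (<-trans 2+i<a a<x)) 2+i<v)))
    where
    2+i<a : suc (suc i) < a
    2+i<a = ≤∧≢⇒< (≤∧≢⇒< 1+i≤a (a≢1+i ∘ sym)) (a≢2+i ∘ sym)
    passes : insertRow a (u ++ suc i ∷ suc (suc i) ∷ v) ≡
             map₁ (λ w → u ++ suc i ∷ suc (suc i) ∷ w) (insertRow a v)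
    passes = trans r (cong (map₁ (λ w → u ++ suc i ∷ w)) (insertRow-≥ (<⇒≤ 2+i<a) refl))

  after-pairs : ∀ {a b} → suc (suc i) < a → Avoids i (suc (suc i)) b → ∀ L₁ L₂ L₃ →
                All (PairAvoids i (suc (suc i))) L₁ → All (PairAvoids i (suc (suc i))) L₂ →
                All (PairAvoids i (suc (suc i))) L₃ →
                After (foldl rBS [] (L₁ ++ (suc i , a) ∷ L₂ ++ (suc (suc i) , b) ∷ L₃))
  after-pairs 2+i<a b-avoids L₁ L₂ L₃ g₁ g₂ g₃ =
    foldl-rBS-stages before-step (insert-1+i 2+i<a) between-step (insert-2+i b-avoids) after-step
      L₁ L₂ L₃ g₁ g₂ g₃ ([] , [])

-- Case (6): the pairs (i+1, a) and (i-1, b), a < b, are inserted in this order; here i = d + 1.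
module Case6 (d : ℕ) where
  d<2+d : d < suc (suc d)
  d<2+d = m<n⇒m<1+n (n<1+n d)

  small≢2+d : ∀ {x} → x < d → x ≢ suc (suc d)
  small≢2+d x<d = <⇒≢ (<-trans x<d d<2+d)

  Bumpable : Tableau → Set
  Bumpable T = ∃₂ λ u v → firstRow T ≡ u ++ suc (suc d) ∷ v × All (_< d) u × All (_≢ suc (suc d)) v

  Before : Tableau → Set
  Before = AllT (Avoids (suc d) d)

  Between : Tableau → Set
  Between T = AllT (_≢ suc d) T × (All (_≢ suc (suc d)) (firstRow T) ⊎ Bumpable T)

  before-step : rBS-Invariant (PairAvoids (suc d) d) Before
  before-step T (ga , gb) avoid = rBS-All T avoid ga gb

  insert-2+d : ∀ {a} → Avoids (suc d) d a → ∀ T → Before T → Between (rBS T (suc (suc d) , a))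
  insert-2+d {a} (a≢1+d , _) T avoid =
    rBS-All T (All.map (All.map proj₁) avoid) 1+n≢n a≢1+d ,
    inj₂ (bumpable (insertionView (suc (suc d)) (firstRow T)))
    where
    row-avoids : All (Avoids (suc d) d) (firstRow T)
    row-avoids = firstRow-All T avoid
    small : ∀ {x} → x ≤ suc (suc d) × Avoids (suc d) d x → x < d
    small (x≤2+d , x≢1+d , x≢2+d , x≢d) =
      ≤∧≢⇒< (s≤s⁻¹ (≤1+n-avoid⇒< x≤2+d x≢1+d x≢2+d)) x≢d
    bumpable : InsertionView (suc (suc d)) (firstRow T) → Bumpable (rBS T (suc (suc d) , a))
    bumpable (appends row≤2+d q) =
      firstRow T , [] , rBS-firstRow T _ a refl q , All.zipWith small (row≤2+d , row-avoids) , []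
    bumpable (replaces u c w eq u≤2+d _ q) =
      u , w , rBS-firstRow T _ a refl q ,
      All.zipWith small (u≤2+d , ++⁻ˡ u (subst (All _) eq row-avoids)) ,
      All.map (proj₁ ∘ proj₂) (All.tail (++⁻ʳ u (subst (All _) eq row-avoids)))

  between-step : rBS-Invariant (PairAvoids (suc d) d) Between
  between-step T {a , b} ((a≢1+d , a≢2+d , _) , (b≢1+d , _)) (no-1+d , state) =
    rBS-All T no-1+d a≢1+d b≢1+d , step state
    where
    step : All (_≢ suc (suc d)) (firstRow T) ⊎ Bumpable T →
           All (_≢ suc (suc d)) (firstRow (rBS T (a , b))) ⊎ Bumpable (rBS T (a , b))
    step (inj₁ no-2+d) = inj₁ (rBS-firstRow-All T a b refl refl (insertRow-All (firstRow T) no-2+d a≢2+d))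
    step (inj₂ (u , v , eq , u<d , v≢2+d)) with pivotInsertion a u (suc (suc d)) v
    ... | bumps-prefix {u′} q r =
      inj₂ (u′ , v , rBS-firstRow T a b eq r , proj₂ (bumps-prefix-< u<d q) , v≢2+d)
    ... | bumps-pivot _ r =
      inj₁ (rBS-firstRow-All T a b eq r (++⁺ (All.map small≢2+d u<d) (a≢2+d ∷ v≢2+d)))
    ... | passes-pivot _ r =
      inj₂ (u , proj₁ (insertRow a v) , rBS-firstRow T a b eq r , u<d , insertRow-All v v≢2+d a≢2+d)

  -- Inserting i-1 = d bumps i+1 out of the first row, since everything before it is < d.
  insert-d : ∀ {b} → b ≢ suc d → ∀ T → Between T → Unpivoted (suc d) (rBS T (d , b))
  insert-d {b} b≢1+d T (no-1+d , state) = rBS-All T no-1+d (<⇒≢ (n<1+n d)) b≢1+d , first state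
    where
    first : All (_≢ suc (suc d)) (firstRow T) ⊎ Bumpable T →
            All (_≢ suc (suc d)) (firstRow (rBS T (d , b)))
    first (inj₁ no-2+d) = rBS-firstRow-All T d b refl refl (insertRow-All (firstRow T) no-2+d (<⇒≢ d<2+d))
    first (inj₂ (u , v , eq , u<d , v≢2+d)) with pivotInsertion d u (suc (suc d)) v
    ... | bumps-prefix q _ =
      contradiction (proj₁ (insertRow-bumped u u<d q)) (<-asym (proj₁ (bumps-prefix-< u<d q)))
    ... | bumps-pivot _ r =
      rBS-firstRow-All T d b eq r (++⁺ (All.map small≢2+d u<d) (<⇒≢ d<2+d ∷ v≢2+d))
    ... | passes-pivot 2+d≤d _ = contradiction 2+d≤d (<⇒≱ d<2+d)

  after-step : rBS-Invariant (PairAvoids (suc d) d) (Unpivoted (suc d))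
  after-step T ((a≢1+d , a≢2+d , _) , (b≢1+d , _)) = Unpivoted-step (suc d) T (a≢1+d , b≢1+d , a≢2+d)

  after-pairs : ∀ {a b} → Avoids (suc d) d a → b ≢ suc d → ∀ L₁ L₂ L₃ →
                All (PairAvoids (suc d) d) L₁ → All (PairAvoids (suc d) d) L₂ →
                All (PairAvoids (suc d) d) L₃ →
                Unpivoted (suc d) (foldl rBS [] (L₁ ++ (suc (suc d) , a) ∷ L₂ ++ (d , b) ∷ L₃))
  after-pairs a-avoids b≢1+d L₁ L₂ L₃ g₁ g₂ g₃ =
    foldl-rBS-stages before-step (insert-2+d a-avoids) between-step (insert-d b≢1+d) after-step
      L₁ L₂ L₃ g₁ g₂ g₃ []

InRange : ℕ → ℕ → Set
InRange n q = 1 ≤ q × q ≤ n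

app-suc : ∀ {n} (w : Fin n → Fin n) k (k<n : k < n) → app w (suc k) ≡ suc (toℕ (w (fromℕ< k<n)))
app-suc {n} w k k<n with k <? n
... | yes _   = refl
... | no  k≮n = contradiction k<n k≮n

app-involutive : ∀ {n} (w : Fin n → Fin n) → IsInvolution w → ∀ {q} → InRange n q → app w (app w q) ≡ q
app-involutive w w-inv {suc k} (_ , k<n)
  rewrite app-suc w k k<n
        | app-suc w (toℕ (w (fromℕ< k<n))) (toℕ<n _)
        | fromℕ<-toℕ (w (fromℕ< k<n)) (toℕ<n (w (fromℕ< k<n)))
        | w-inv (fromℕ< k<n) = cong suc (toℕ-fromℕ< k<n)

app-InRange : ∀ {n} (w : Fin n → Fin n) {q} → InRange n q → InRange n (app w q)
app-InRange w {suc k} (_ , k<n) rewrite app-suc w k k<n = s≤s z≤n , toℕ<n _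

app-involutive-image : ∀ {n} (w : Fin n → Fin n) → IsInvolution w → ∀ {q x} → InRange n q →
                       app w q ≡ x → app w x ≡ q
app-involutive-image w w-inv q-range refl = app-involutive w w-inv q-range

-- (w q, q) with w q < q is the entry of cyclesOf w for the 2-cycle through q.
module ClosingPair {n} (w : Fin n → Fin n) (w-inv : IsInvolution w) {q} (q-range : InRange n q)
                   (closes : app w q < q) where

  image : ∀ {x} → app w q ≡ x → app w x ≡ q
  image = app-involutive-image w w-inv q-range

  avoids-fixed : ∀ {x} → app w x ≡ x → app w q ≢ x × q ≢ x
  avoids-fixed wx≡x = (λ wq≡x → <-irrefl (trans wq≡x (trans (sym wx≡x) (image wq≡x))) closes)
                    , λ { refl → <-irrefl wx≡x closes }

  avoids-opener : ∀ {x} → x < app w x → q ≢ app w x → app w q ≢ x × q ≢ x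
  avoids-opener x<wx q≢wx = (λ wq≡x → q≢wx (sym (image wq≡x)))
                          , λ { refl → <-asym x<wx closes }

  first-avoids-closer : ∀ {x} → app w x < x → app w q ≢ x
  first-avoids-closer wx<x wq≡x = <-asym closes (subst₂ _<_ (image wq≡x) (sym wq≡x) wx<x)

range : ℕ → List ℕ
range n = map suc (upTo n)

range-sorted : ∀ n → AllPairs _<_ (range n)
range-sorted n = AllPairs.map⁺ (AllPairs.applyUpTo⁺₁ id n (λ j<k _ → s≤s j<k))

range-InRange : ∀ n → All (InRange n) (range n)
range-InRange n = map⁺ (applyUpTo⁺₁ id n (λ k<n → s≤s z≤n , k<n))

∈-range : ∀ {n q} → InRange n q → q ∈ range n
∈-range {q = suc k} (_ , k<n) = ∈-map⁺ suc (∈-upTo⁺ k<n)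

split-sorted : ∀ {P : ℕ → Set} {k xs} → AllPairs _<_ xs → All P xs → k ∈ xs →
  ∃₂ λ X Y → xs ≡ X ++ k ∷ Y × All (λ q → P q × q < k) X × All (λ q → P q × k < q) Y
split-sorted (x<xs ∷ _) (_ ∷ pxs) (here refl) = [] , _ , refl , [] , All.zip (pxs , x<xs)
split-sorted (x<xs ∷ s) (px ∷ pxs) (there k∈xs) with split-sorted s pxs k∈xs
... | X , Y , refl , pX , pY = _ ∷ X , Y , refl , (px , All.lookup x<xs k∈xs) ∷ pX , pY

split-sorted₂ : ∀ {P : ℕ → Set} {j k xs} → AllPairs _<_ xs → All P xs →
                j ∈ xs → k ∈ xs → j < k →
  ∃ λ X → ∃₂ λ M Y → xs ≡ X ++ j ∷ M ++ k ∷ Y × All (λ q → P q × q < j) X ×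
                     All (λ q → P q × j < q × q < k) M × All (λ q → P q × k < q) Y
split-sorted₂ (_ ∷ _) (_ ∷ _) (here refl) (here refl) j<k = contradiction j<k (<-irrefl refl)
split-sorted₂ (x<xs ∷ s) (_ ∷ pxs) (here refl) (there k∈xs) _ with split-sorted s pxs k∈xs
... | M , Y , refl , pM , pY =
  [] , M , Y , refl , [] , All.zipWith (λ ((pq , q<k) , j<q) → pq , j<q , q<k) (pM , ++⁻ˡ M x<xs) , pY
split-sorted₂ (x<xs ∷ _) (_ ∷ _) (there j∈xs) (here refl) j<k =
  contradiction (All.lookup x<xs j∈xs) (<⇒≯ j<k)
split-sorted₂ (x<xs ∷ s) (px ∷ pxs) (there j∈xs) (there k∈xs) j<k
  with split-sorted₂ s pxs j∈xs k∈xs j<k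
... | X , M , Y , refl , pX , pM , pY = _ ∷ X , M , Y , refl , (px , All.lookup x<xs j∈xs) ∷ pX , pM , pY

cycleAt : ∀ {n} → (Fin n → Fin n) → ℕ → List (ℕ × ℕ)
cycleAt w q = if app w q <ᵇ q then [ (app w q , q) ] else []

fixedAt : ∀ {n} → (Fin n → Fin n) → ℕ → List (ℕ × ℕ)
fixedAt w q = if app w q ≡ᵇ q then [ (q , q) ] else []

-- cyclesOf and fixedOf scan range n with a local function; solving these metavariables names it.
mutual
  cycleScan : ∀ {n} → (Fin n → Fin n) → List ℕ → List (ℕ × ℕ)
  cycleScan = _

  cyclesOf-scan : ∀ {n} (w : Fin n → Fin n) → cyclesOf w ≡ cycleScan w (range n)
  cyclesOf-scan {n} w with range n
  ... | _ = refl

mutual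
  fixedScan : ∀ {n} → (Fin n → Fin n) → List ℕ → List (ℕ × ℕ)
  fixedScan = _

  fixedOf-scan : ∀ {n} (w : Fin n → Fin n) → fixedOf w ≡ fixedScan w (range n)
  fixedOf-scan {n} w with range n
  ... | _ = refl

cyclesOf-concatMap : ∀ {n} (w : Fin n → Fin n) → cyclesOf w ≡ concatMap (cycleAt w) (range n)
cyclesOf-concatMap {n} w = trans (cyclesOf-scan w) (scan (range n))
  where
  scan : ∀ qs → cycleScan w qs ≡ concatMap (cycleAt w) qs
  scan []       = refl
  scan (q ∷ qs) with app w q <ᵇ q
  ... | true  = cong (_ ∷_) (scan qs)
  ... | false = scan qs

fixedOf-concatMap : ∀ {n} (w : Fin n → Fin n) → fixedOf w ≡ concatMap (fixedAt w) (range n)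
fixedOf-concatMap {n} w = trans (fixedOf-scan w) (scan (range n))
  where
  scan : ∀ qs → fixedScan w qs ≡ concatMap (fixedAt w) qs
  scan []       = refl
  scan (q ∷ qs) with app w q ≡ᵇ q
  ... | true  = cong (_ ∷_) (scan qs)
  ... | false = scan qs

concatMap-All : ∀ {A B : Set} {P : B → Set} {Q : A → Set} (f : A → List B) {xs} →
                (∀ {x} → Q x → All P (f x)) → All Q xs → All P (concatMap f xs)
concatMap-All f h qs = concat⁺ (map⁺ (All.map h qs))

concatMap-map-local : ∀ {A B : Set} (f g : A → List B) (h : B → B) {xs} →
                      All (λ x → g x ≡ map h (f x)) xs → concatMap g xs ≡ map h (concatMap f xs)
concatMap-map-local f g h []                    = refl
concatMap-map-local f g h {x ∷ xs} (gx ∷ gxs) =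
  trans (cong₂ _++_ gx (concatMap-map-local f g h gxs)) (sym (map-++ h (f x) (concatMap f xs)))

concatMap-cong-local : ∀ {A B : Set} (f g : A → List B) {xs} →
                       All (λ x → g x ≡ f x) xs → concatMap g xs ≡ concatMap f xs
concatMap-cong-local f g eqs = cong concat (map-cong-local eqs)

cycleAt-All : ∀ {n} (w : Fin n → Fin n) {P : ℕ × ℕ → Set} q →
              (app w q < q → P (app w q , q)) → All P (cycleAt w q)
cycleAt-All w q h with app w q <ᵇ q in lt
... | true  = h (<ᵇ-true⁻¹ lt) ∷ []
... | false = []

fixedAt-All : ∀ {n} (w : Fin n → Fin n) {P : ℕ × ℕ → Set} q →
              (app w q ≡ q → P (q , q)) → All P (fixedAt w q)
fixedAt-All w q h with app w q ≡ᵇ q in eq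
... | true  = h (≡ᵇ-true⁻¹ eq) ∷ []
... | false = []

cycleAt-image : ∀ {n} (w : Fin n → Fin n) {q p} → app w q ≡ p →
                cycleAt w q ≡ (if p <ᵇ q then [ (p , q) ] else [])
cycleAt-image w {q} = cong (λ p → if p <ᵇ q then [ (p , q) ] else [])

cycleAt-closing : ∀ {n} (w : Fin n → Fin n) {q p} → app w q ≡ p → p < q → cycleAt w q ≡ [ (p , q) ]
cycleAt-closing w {q} {p} wq≡p p<q =
  trans (cycleAt-image w wq≡p) (cong (if_then [ (p , q) ] else []) (<ᵇ-true p<q))

cycleAt-not-closing : ∀ {n} (w : Fin n → Fin n) {q p} → app w q ≡ p → q ≤ p → cycleAt w q ≡ []
cycleAt-not-closing w {q} {p} wq≡p q≤p =
  trans (cycleAt-image w wq≡p) (cong (if_then [ (p , q) ] else []) (<ᵇ-false q≤p))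

fixedAt-image : ∀ {n} (w : Fin n → Fin n) {q p} → app w q ≡ p →
                fixedAt w q ≡ (if p ≡ᵇ q then [ (q , q) ] else [])
fixedAt-image w {q} = cong (λ p → if p ≡ᵇ q then [ (q , q) ] else [])

fixedAt-fixed : ∀ {n} (w : Fin n → Fin n) {q} → app w q ≡ q → fixedAt w q ≡ [ (q , q) ]
fixedAt-fixed w {q} wq≡q =
  trans (fixedAt-image w wq≡q) (cong (if_then [ (q , q) ] else []) (≡ᵇ-refl q))

fixedAt-moved : ∀ {n} (w : Fin n → Fin n) {q p} → app w q ≡ p → p ≢ q → fixedAt w q ≡ []
fixedAt-moved w {q} wq≡p p≢q =
  trans (fixedAt-image w wq≡p) (cong (if_then [ (q , q) ] else []) (≡ᵇ-false p≢q))

range-split : ∀ {n i} → 1 ≤ i → i < n →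
  ∃₂ λ X Y → range n ≡ X ++ i ∷ suc i ∷ Y ×
             All (λ q → InRange n q × q < i) X × All (λ q → InRange n q × suc i < q) Y
range-split {n} {i} 1≤i i<n
  with split-sorted₂ (range-sorted n) (range-InRange n)
                     (∈-range (1≤i , <⇒≤ i<n)) (∈-range (s≤s z≤n , i<n)) (n<1+n i)
... | X , [] , Y , eq , pX , [] , pY = X , Y , eq , pX , pY
... | _ , _ ∷ _ , _ , _ , _ , (_ , i<q , q<1+i) ∷ _ , _ = contradiction i<q (<⇒≱ q<1+i)

λm-decomposition : ∀ {n} (w : Fin n → Fin n) L c Q → cyclesOf w ++ fixedOf w ≡ L ++ (c , c) ∷ Q →
                   λm w ≡ shape (foldl rBS (proj₁ (rsk (foldl rBS [] L) c)) Q)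
λm-decomposition w L c Q eq = begin
  λm w
    ≡⟨ cong (shape ∘ foldl rBS []) eq ⟩
  shape (foldl rBS [] (L ++ (c , c) ∷ Q))
    ≡⟨ cong shape (foldl-++ rBS [] L _) ⟩
  shape (foldl rBS (rBS (foldl rBS [] L) (c , c)) Q)
    ≡⟨ cong (λ T → shape (foldl rBS T Q)) (rBS-diagonal _ c) ⟩
  shape (foldl rBS (proj₁ (rsk (foldl rBS [] L) c)) Q) ∎
  where
  open ≡-Reasoning
  rBS-diagonal : ∀ T a → rBS T (a , a) ≡ proj₁ (rsk T a)
  rBS-diagonal T a rewrite ≡ᵇ-refl a = refl

module SwapAway (i : ℕ) = Relabel (swap i) (swap-injective i) {Ins = _≢ i} {Ent = _≢ i}
  (λ _ _ v≢i e≢i → swap-<ᵇ-≢ i v≢i e≢i)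
  (λ _ e≢i _ → e≢i)

module Conjugation {n} (y z : Fin n → Fin n) (i : ℕ) (y-inv : IsInvolution y) (1≤i : 1 ≤ i) (i<n : i < n)
  (z-conj : ∀ k → 1 ≤ k → k ≤ n → app z k ≡ swap i (app y (swap i k)))
  (y-i : app y i ≡ i) (1+i-moved : app y (suc i) ≢ suc i) where

  1+i-range : InRange n (suc i)
  1+i-range = s≤s z≤n , i<n

  y-1+i≢i : app y (suc i) ≢ i
  y-1+i≢i y-1+i≡i = 1+n≢n (trans (sym (app-involutive-image y y-inv 1+i-range y-1+i≡i)) y-i)

  z-away : ∀ {q} → InRange n q → q ≢ i → q ≢ suc i → app z q ≡ swap i (app y q)
  z-away (1≤q , q≤n) q≢i q≢1+i =
    trans (z-conj _ 1≤q q≤n) (cong (swap i ∘ app y) (swap-fix q≢i q≢1+i))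

  z-i : app z i ≡ app y (suc i)
  z-i = trans (z-conj i 1≤i (<⇒≤ i<n))
              (trans (cong (swap i ∘ app y) (swap-i i)) (swap-fix y-1+i≢i 1+i-moved))

  z-1+i : app z (suc i) ≡ suc i
  z-1+i = trans (z-conj (suc i) (s≤s z≤n) i<n)
                (trans (cong (swap i ∘ app y) (swap-1+i i)) (trans (cong (swap i) y-i) (swap-i i)))

  X : List ℕ
  X = proj₁ (range-split 1≤i i<n)

  Y : List ℕ
  Y = proj₁ (proj₂ (range-split 1≤i i<n))

  range-X-i-Y : range n ≡ X ++ i ∷ suc i ∷ Y
  range-X-i-Y = proj₁ (proj₂ (proj₂ (range-split 1≤i i<n)))

  X-below : All (λ q → InRange n q × q < i) X
  X-below = proj₁ (proj₂ (proj₂ (proj₂ (range-split 1≤i i<n))))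

  Y-above : All (λ q → InRange n q × suc i < q) Y
  Y-above = proj₂ (proj₂ (proj₂ (proj₂ (range-split 1≤i i<n))))

  concatMap-range : ∀ (f : ℕ → List (ℕ × ℕ)) →
                    concatMap f (range n) ≡ concatMap f X ++ f i ++ f (suc i) ++ concatMap f Y
  concatMap-range f = trans (cong (concatMap f) range-X-i-Y) (concatMap-++ f X _)

  FX : List (ℕ × ℕ)
  FX = concatMap (fixedAt y) X

  FY : List (ℕ × ℕ)
  FY = concatMap (fixedAt y) Y

  -- T₀ is P_rBS(y) just before its fixed point i is inserted.
  T₀ : Tableau
  T₀ = foldl rBS [] (cyclesOf y ++ FX)

  swapPair : ℕ × ℕ → ℕ × ℕ
  swapPair = pairMap (swap i)

  away-≢ : ∀ {q} → q < i ⊎ suc i < q → q ≢ i × q ≢ suc i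
  away-≢ (inj₁ q<i)   = <⇒≢ q<i , <⇒≢ (m<n⇒m<1+n q<i)
  away-≢ (inj₂ 1+i<q) = 1+m<n⇒n≢m 1+i<q , >⇒≢ 1+i<q

  cycleAt-away : ∀ {q} → InRange n q × (q < i ⊎ suc i < q) → cycleAt z q ≡ map swapPair (cycleAt y q)
  cycleAt-away {q} (q-range , q-away) = begin
    cycleAt z q
      ≡⟨ cycleAt-image z (z-away q-range q≢i q≢1+i) ⟩
    (if swap i (app y q) <ᵇ q then [ (swap i (app y q) , q) ] else [])
      ≡⟨ cong₂ (λ b k → if b then [ (swap i (app y q) , k) ] else []) order (sym σq≡q) ⟩
    (if app y q <ᵇ q then [ swapPair (app y q , q) ] else [])
      ≡⟨ if-float (map swapPair) (app y q <ᵇ q) ⟨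
    map swapPair (cycleAt y q) ∎
    where
    open ≡-Reasoning
    q≢i : q ≢ i
    q≢i = proj₁ (away-≢ q-away)
    q≢1+i : q ≢ suc i
    q≢1+i = proj₂ (away-≢ q-away)
    σq≡q : swap i q ≡ q
    σq≡q = swap-fix q≢i q≢1+i
    order : (swap i (app y q) <ᵇ q) ≡ (app y q <ᵇ q)
    order = trans (cong (swap i (app y q) <ᵇ_) (sym σq≡q))
                  (swap-<ᵇ-away i q≢i q≢1+i)

  fixedAt-away : ∀ {q} → InRange n q × (q < i ⊎ suc i < q) → fixedAt z q ≡ fixedAt y q
  fixedAt-away {q} (q-range , q-away) =
    trans (fixedAt-image z (z-away q-range q≢i q≢1+i))
          (cong (if_then [ (q , q) ] else [])
                (trans (cong (swap i (app y q) ≡ᵇ_) (sym (swap-fix q≢i q≢1+i)))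
                       (≡ᵇ-injective (swap-injective i) (app y q) q)))
    where
    q≢i : q ≢ i
    q≢i = proj₁ (away-≢ q-away)
    q≢1+i : q ≢ suc i
    q≢1+i = proj₂ (away-≢ q-away)

  X-away : All (λ q → InRange n q × (q < i ⊎ suc i < q)) X
  X-away = All.map (Product.map₂ inj₁) X-below

  Y-away : All (λ q → InRange n q × (q < i ⊎ suc i < q)) Y
  Y-away = All.map (Product.map₂ inj₂) Y-above

  -- The 2-cycle through i+1 of y becomes the 2-cycle through i of z, listed at the same place.
  cyclesOf-z : cyclesOf z ≡ map swapPair (cyclesOf y)
  cyclesOf-z = begin
    cyclesOf z
      ≡⟨ trans (cyclesOf-concatMap z) (concatMap-range (cycleAt z)) ⟩
    Cz X ++ cycleAt z i ++ cycleAt z (suc i) ++ Cz Y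
      ≡⟨ cong₂ _++_ (pointwise X-away) (cong₂ _++_ z-at-i (cong₂ _++_ z-at-1+i (pointwise Y-away))) ⟩
    map swapPair (Cy X) ++ map swapPair (cycleAt y (suc i)) ++ map swapPair (Cy Y)
      ≡⟨ cong (map swapPair (Cy X) ++_) (map-++ swapPair (cycleAt y (suc i)) (Cy Y)) ⟨
    map swapPair (Cy X) ++ map swapPair (cycleAt y (suc i) ++ Cy Y)
      ≡⟨ map-++ swapPair (Cy X) _ ⟨
    map swapPair (Cy X ++ cycleAt y (suc i) ++ Cy Y)
      ≡⟨ cong (λ L → map swapPair (Cy X ++ L ++ cycleAt y (suc i) ++ Cy Y))
              (cycleAt-not-closing y y-i ≤-refl) ⟨
    map swapPair (Cy X ++ cycleAt y i ++ cycleAt y (suc i) ++ Cy Y)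
      ≡⟨ cong (map swapPair) (trans (cyclesOf-concatMap y) (concatMap-range (cycleAt y))) ⟨
    map swapPair (cyclesOf y) ∎
    where
    open ≡-Reasoning
    Cy Cz : List ℕ → List (ℕ × ℕ)
    Cy = concatMap (cycleAt y)
    Cz = concatMap (cycleAt z)
    pointwise : ∀ {xs} → All (λ q → InRange n q × (q < i ⊎ suc i < q)) xs → Cz xs ≡ map swapPair (Cy xs)
    pointwise = concatMap-map-local (cycleAt y) (cycleAt z) swapPair ∘ All.map cycleAt-away
    z-at-i : cycleAt z i ≡ map swapPair (cycleAt y (suc i))
    z-at-i = begin
      cycleAt z i
        ≡⟨ cycleAt-image z z-i ⟩
      (if app y (suc i) <ᵇ i then [ (app y (suc i) , i) ] else [])
        ≡⟨ cong₂ (λ b p → if b then [ p ] else [])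
                 (<ᵇ-cong (λ t<1+i → ≤∧≢⇒< (s≤s⁻¹ t<1+i) y-1+i≢i) m<n⇒m<1+n)
                 (sym (cong₂ _,_ (swap-fix y-1+i≢i 1+i-moved) (swap-1+i i))) ⟩
      (if app y (suc i) <ᵇ suc i then [ swapPair (app y (suc i) , suc i) ] else [])
        ≡⟨ if-float (map swapPair) (app y (suc i) <ᵇ suc i) ⟨
      map swapPair (cycleAt y (suc i)) ∎
    z-at-1+i : cycleAt z (suc i) ≡ []
    z-at-1+i = cycleAt-not-closing z z-1+i ≤-refl

  fixedOf-y : fixedOf y ≡ FX ++ (i , i) ∷ FY
  fixedOf-y = begin
    fixedOf y
      ≡⟨ trans (fixedOf-concatMap y) (concatMap-range (fixedAt y)) ⟩
    FX ++ fixedAt y i ++ fixedAt y (suc i) ++ FY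
      ≡⟨ cong (FX ++_) (cong₂ _++_ (fixedAt-fixed y y-i) (cong (_++ FY) (fixedAt-moved y refl 1+i-moved))) ⟩
    FX ++ (i , i) ∷ FY ∎
    where open ≡-Reasoning

  fixedOf-z : fixedOf z ≡ FX ++ (suc i , suc i) ∷ FY
  fixedOf-z = begin
    fixedOf z
      ≡⟨ trans (fixedOf-concatMap z) (concatMap-range (fixedAt z)) ⟩
    concatMap (fixedAt z) X ++ fixedAt z i ++ fixedAt z (suc i) ++ concatMap (fixedAt z) Y
      ≡⟨ cong₂ _++_ (concatMap-cong-local (fixedAt y) (fixedAt z) (All.map fixedAt-away X-away))
           (cong₂ _++_ (fixedAt-moved z z-i y-1+i≢i)
             (cong₂ _++_ (fixedAt-fixed z z-1+i)
               (concatMap-cong-local (fixedAt y) (fixedAt z) (All.map fixedAt-away Y-away)))) ⟩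
    FX ++ (suc i , suc i) ∷ FY ∎
    where open ≡-Reasoning

  FX-below : All (λ (a , b) → a < i × b < i) FX
  FX-below = concatMap-All (fixedAt y) (λ {q} (_ , q<i) → fixedAt-All y q (λ _ → q<i , q<i)) X-below

  FY-above : All (Above (suc i)) FY
  FY-above = concatMap-All (fixedAt y) (λ {q} (_ , 1+i<q) → fixedAt-All y q (λ _ → 1+i<q , 1+i<q)) Y-above

  FY-above₂ : app y (suc (suc i)) ≢ suc (suc i) → All (Above (suc (suc i))) FY
  FY-above₂ 2+i-moved = concatMap-All (fixedAt y) above₂ Y-above
    where
    above₂ : ∀ {q} → InRange n q × suc i < q → All (Above (suc (suc i))) (fixedAt y q)
    above₂ {q} (_ , 1+i<q) =
      fixedAt-All y q (λ yq≡q → let 2+i<q = ≤∧≢⇒< 1+i<q (2+i-moved ∘ ≡2+i yq≡q) in 2+i<q , 2+i<q)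
      where
      ≡2+i : app y q ≡ q → suc (suc i) ≡ q → app y (suc (suc i)) ≡ suc (suc i)
      ≡2+i yq≡q refl = yq≡q

  cycles-avoid-i : All (λ (a , b) → a ≢ i × b ≢ i) (cyclesOf y)
  cycles-avoid-i = subst (All _) (sym (cyclesOf-concatMap y))
    (concatMap-All (cycleAt y)
      (λ {q} q-range → cycleAt-All y q (λ closes → ClosingPair.avoids-fixed y y-inv q-range closes y-i))
      (range-InRange n))

  λm-y : λm y ≡ shape (foldl rBS (proj₁ (rsk T₀ i)) FY)
  λm-y = λm-decomposition y (cyclesOf y ++ FX) i FY
           (trans (cong (cyclesOf y ++_) fixedOf-y) (sym (++-assoc (cyclesOf y) FX _)))

  λm-z : λm z ≡ shape (foldl rBS (proj₁ (rsk (mapT (swap i) T₀) (suc i))) FY)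
  λm-z = trans (λm-decomposition z (map swapPair (cyclesOf y ++ FX)) (suc i) FY z-lists)
               (cong (λ T → shape (foldl rBS (proj₁ (rsk T (suc i))) FY))
                     (SwapAway.foldl-rBS-map i [] (cyclesOf y ++ FX)
                       (All.map relabelable (++⁺ cycles-avoid-i FX-avoid-i)) []))
    where
    FX-avoid-i : All (λ (a , b) → a ≢ i × b ≢ i) FX
    FX-avoid-i = All.map (λ (a<i , b<i) → <⇒≢ a<i , <⇒≢ b<i) FX-below
    relabelable : ∀ {o} → (λ (a , b) → a ≢ i × b ≢ i) o → SwapAway.Relabelable i o
    relabelable (a≢i , b≢i) = a≢i , a≢i , b≢i
    FX-fixed : map swapPair FX ≡ FX
    FX-fixed = map-id-local (All.map (λ (a<i , b<i) → cong₂ _,_ (swap-fix-< a<i) (swap-fix-< b<i)) FX-below)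
    z-lists : cyclesOf z ++ fixedOf z ≡ map swapPair (cyclesOf y ++ FX) ++ (suc i , suc i) ∷ FY
    z-lists = begin
      cyclesOf z ++ fixedOf z
        ≡⟨ cong₂ _++_ cyclesOf-z fixedOf-z ⟩
      map swapPair (cyclesOf y) ++ FX ++ (suc i , suc i) ∷ FY
        ≡⟨ cong (λ F → map swapPair (cyclesOf y) ++ F ++ (suc i , suc i) ∷ FY) FX-fixed ⟨
      map swapPair (cyclesOf y) ++ map swapPair FX ++ (suc i , suc i) ∷ FY
        ≡⟨ ++-assoc (map swapPair (cyclesOf y)) (map swapPair FX) _ ⟨
      (map swapPair (cyclesOf y) ++ map swapPair FX) ++ (suc i , suc i) ∷ FY
        ≡⟨ cong (_++ (suc i , suc i) ∷ FY) (map-++ swapPair (cyclesOf y) FX) ⟨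
      map swapPair (cyclesOf y ++ FX) ++ (suc i , suc i) ∷ FY ∎
      where open ≡-Reasoning

  λm-unpivoted : Unpivoted i T₀ → λm y ≡ λm z
  λm-unpivoted unpivoted = trans λm-y (trans (shape-rsk-swap-unpivoted i T₀ FY unpivoted FY-above) (sym λm-z))

  λm-pivoted : app y (suc (suc i)) ≢ suc (suc i) → Pivoted i T₀ → λm y ≡ λm z
  λm-pivoted 2+i-moved pivoted =
    trans λm-y (trans (shape-rsk-swap-pivoted i T₀ FY pivoted (FY-above₂ 2+i-moved)) (sym λm-z))

  -- i+1 is then only ever inserted as the larger entry of a pair, never into the first row.
  T₀-unpivoted : app y (suc i) < suc i → Unpivoted i T₀
  T₀-unpivoted 1+i-closes = foldl-rBS-invariant (Unpivoted-step i) [] _ (++⁺ cycles-guard FX-guard) ([] , [])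
    where
    cycles-guard : All (λ (a , b) → a ≢ i × b ≢ i × a ≢ suc i) (cyclesOf y)
    cycles-guard = subst (All _) (sym (cyclesOf-concatMap y))
      (concatMap-All (cycleAt y) (λ {q} q-range → cycleAt-All y q λ closes →
        let open ClosingPair y y-inv q-range closes
            (yq≢i , q≢i) = avoids-fixed y-i
        in yq≢i , q≢i , first-avoids-closer 1+i-closes)
      (range-InRange n))
    FX-guard : All (λ (a , b) → a ≢ i × b ≢ i × a ≢ suc i) FX
    FX-guard = All.map (λ (a<i , b<i) → <⇒≢ a<i , <⇒≢ b<i , <⇒≢ (m<n⇒m<1+n a<i)) FX-below

  cycle-avoids : ∀ {a e b q} → app y (suc i) ≡ a → suc i < a → app y e ≡ b → e < b →
                 InRange n q → q ≢ a → q ≢ b → app y q < q → PairAvoids i e (app y q , q)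
  cycle-avoids {e = e} {q = q} y-1+i≡a 1+i<a ye≡b e<b q-range q≢a q≢b closes =
    let open ClosingPair y y-inv q-range closes
        yq≢i , q≢i     = avoids-fixed y-i
        yq≢1+i , q≢1+i = avoids-opener (subst (suc i <_) (sym y-1+i≡a) 1+i<a)
                                       (subst (q ≢_) (sym y-1+i≡a) q≢a)
        yq≢e , q≢e     = avoids-opener (subst (e <_) (sym ye≡b) e<b) (subst (q ≢_) (sym ye≡b) q≢b)
    in (yq≢i , yq≢1+i , yq≢e) , (q≢i , q≢1+i , q≢e)

  FX-avoids : ∀ {e b} → app y e ≡ b → e < b → All (PairAvoids i e) FX
  FX-avoids ye≡b e<b = concatMap-All (fixedAt y) (λ {q} (_ , q<i) → fixedAt-All y q λ yq≡q →
    let q-avoids = <⇒≢ q<i , <⇒≢ (m<n⇒m<1+n q<i) , λ { refl → <-irrefl (trans (sym yq≡q) ye≡b) e<b }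
    in q-avoids , q-avoids) X-below

  two-openers : ∀ {a e b} → app y (suc i) ≡ a → suc i < a →
                InRange n e → app y e ≡ b → e < b → a < b →
    ∃ λ L₁ → ∃₂ λ L₂ L₃ → cyclesOf y ++ FX ≡ L₁ ++ (suc i , a) ∷ L₂ ++ (e , b) ∷ L₃ ×
                         All (PairAvoids i e) L₁ × All (PairAvoids i e) L₂ × All (PairAvoids i e) L₃
  two-openers {a} {e} {b} y-1+i≡a 1+i<a e-range ye≡b e<b a<b
    with split-sorted₂ (range-sorted n) (range-InRange n)
           (∈-range (subst (InRange n) y-1+i≡a (app-InRange y 1+i-range)))
           (∈-range (subst (InRange n) ye≡b (app-InRange y e-range))) a<b
  ... | X₁ , M , X₃ , range≡ , pX₁ , pM , pX₃ =
    Cy X₁ , Cy M , Cy X₃ ++ FX , decomposition ,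
    cycles-avoid (All.map (λ (r , q<a) → r , <⇒≢ q<a , <⇒≢ (<-trans q<a a<b)) pX₁) ,
    cycles-avoid (All.map (λ (r , a<q , q<b) → r , >⇒≢ a<q , <⇒≢ q<b) pM) ,
    ++⁺ (cycles-avoid (All.map (λ (r , b<q) → r , >⇒≢ (<-trans a<b b<q) , >⇒≢ b<q) pX₃))
        (FX-avoids ye≡b e<b)
    where
    open ≡-Reasoning
    Cy : List ℕ → List (ℕ × ℕ)
    Cy = concatMap (cycleAt y)
    cycles-avoid : ∀ {xs} → All (λ q → InRange n q × q ≢ a × q ≢ b) xs → All (PairAvoids i e) (Cy xs)
    cycles-avoid = concatMap-All (cycleAt y) λ {q} (q-range , q≢a , q≢b) →
      cycleAt-All y q (cycle-avoids y-1+i≡a 1+i<a ye≡b e<b q-range q≢a q≢b)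
    decomposition : cyclesOf y ++ FX ≡ Cy X₁ ++ (suc i , a) ∷ Cy M ++ (e , b) ∷ Cy X₃ ++ FX
    decomposition = begin
      cyclesOf y ++ FX
        ≡⟨ cong (_++ FX) (trans (cyclesOf-concatMap y) (cong Cy range≡)) ⟩
      Cy (X₁ ++ a ∷ M ++ b ∷ X₃) ++ FX
        ≡⟨ cong (_++ FX) (concatMap-++ (cycleAt y) X₁ _) ⟩
      (Cy X₁ ++ cycleAt y a ++ Cy (M ++ b ∷ X₃)) ++ FX
        ≡⟨ cong (λ L → (Cy X₁ ++ L) ++ FX)
                (cong₂ _++_ (cycleAt-closing y (app-involutive-image y y-inv 1+i-range y-1+i≡a) 1+i<a)
                            (trans (concatMap-++ (cycleAt y) M _)
                                   (cong (λ L → Cy M ++ L ++ Cy X₃)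
                                         (cycleAt-closing y (app-involutive-image y y-inv e-range ye≡b) e<b)))) ⟩
      (Cy X₁ ++ (suc i , a) ∷ Cy M ++ (e , b) ∷ Cy X₃) ++ FX
        ≡⟨ ++-assoc (Cy X₁) _ FX ⟩
      Cy X₁ ++ (suc i , a) ∷ (Cy M ++ (e , b) ∷ Cy X₃) ++ FX
        ≡⟨ cong (λ L → Cy X₁ ++ (suc i , a) ∷ L) (++-assoc (Cy M) _ FX) ⟩
      Cy X₁ ++ (suc i , a) ∷ Cy M ++ (e , b) ∷ Cy X₃ ++ FX ∎

module Cases {n} (y z : Fin n → Fin n) (d : ℕ) (y-inv : IsInvolution y) (i<n : suc d < n)
  (z-conj : ∀ k → 1 ≤ k → k ≤ n → app z k ≡ swap (suc d) (app y (swap (suc d) k)))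
  (y-i : app y (suc d) ≡ suc d) where

  i : ℕ
  i = suc d

  i+1≡ : i + 1 ≡ suc i
  i+1≡ = +-comm i 1

  i+2≡ : i + 2 ≡ suc (suc i)
  i+2≡ = +-comm i 2

  module Conj (1+i-moved : app y (suc i) ≢ suc i) =
    Conjugation y z i y-inv (s≤s z≤n) i<n z-conj y-i 1+i-moved

  closing : ∀ {a} → HasCycle y a (i + 1) → λm y ≡ λm z
  closing {a} (1≤a , a<i+1 , i+1≤n , ya≡i+1) =
    Conj.λm-unpivoted 1+i-moved (Conj.T₀-unpivoted 1+i-moved y-1+i<1+i)
    where
    a<1+i : a < suc i
    a<1+i = subst (a <_) i+1≡ a<i+1
    y-1+i≡a : app y (suc i) ≡ a
    y-1+i≡a = app-involutive-image y y-inv (1≤a , <⇒≤ (<-≤-trans a<i+1 i+1≤n)) (trans ya≡i+1 i+1≡)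
    y-1+i<1+i : app y (suc i) < suc i
    y-1+i<1+i = subst (_< suc i) (sym y-1+i≡a) a<1+i
    1+i-moved : app y (suc i) ≢ suc i
    1+i-moved = <⇒≢ y-1+i<1+i

  opening-with-2+i : ∀ {a b} → HasCycle y (i + 1) a → HasCycle y (i + 2) b → i + 2 < a → a < b →
                     λm y ≡ λm z
  opening-with-2+i {a} {b} (_ , _ , a≤n , y-i+1≡a) (_ , _ , _ , y-i+2≡b) i+2<a a<b =
    [ Conj.λm-unpivoted 1+i-moved ,
      Conj.λm-pivoted 1+i-moved (>⇒≢ 2+i<b ∘ trans (sym y-2+i≡b)) ]′ T₀-state
    where
    y-1+i≡a : app y (suc i) ≡ a
    y-1+i≡a = trans (cong (app y) (sym i+1≡)) y-i+1≡a
    y-2+i≡b : app y (suc (suc i)) ≡ b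
    y-2+i≡b = trans (cong (app y) (sym i+2≡)) y-i+2≡b
    2+i<a : suc (suc i) < a
    2+i<a = subst (_< a) i+2≡ i+2<a
    2+i<b : suc (suc i) < b
    2+i<b = <-trans 2+i<a a<b
    1+i-moved : app y (suc i) ≢ suc i
    1+i-moved = 1+m<n⇒n≢m (subst (suc (suc i) <_) (sym y-1+i≡a) 2+i<a)
    T₀-state : Case3.After i (Conj.T₀ 1+i-moved)
    T₀-state =
      let L₁ , L₂ , L₃ , decomposition , g₁ , g₂ , g₃ =
            Conj.two-openers 1+i-moved y-1+i≡a (<-trans (n<1+n _) 2+i<a)
              (s≤s z≤n , <⇒≤ (<-≤-trans 2+i<a a≤n)) y-2+i≡b 2+i<b a<b
      in subst (Case3.After i ∘ foldl rBS []) (sym decomposition)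
           (Case3.after-pairs i 2+i<a (Case3.above-avoids i 2+i<b) L₁ L₂ L₃ g₁ g₂ g₃)

  opening-with-i-1 : ∀ {a b} → HasCycle y (i + 1) a → HasCycle y (i ∸ 1) b → i + 2 < a → a < b →
                     λm y ≡ λm z
  opening-with-i-1 {a} {b} (_ , _ , a≤n , y-i+1≡a) (1≤d , d<b , b≤n , yd≡b) i+2<a a<b =
    Conj.λm-unpivoted 1+i-moved T₀-unpivoted
    where
    y-1+i≡a : app y (suc i) ≡ a
    y-1+i≡a = trans (cong (app y) (sym i+1≡)) y-i+1≡a
    2+i<a : suc (suc i) < a
    2+i<a = subst (_< a) i+2≡ i+2<a
    1+i<a : suc i < a
    1+i<a = <-trans (n<1+n _) 2+i<a
    1+i-moved : app y (suc i) ≢ suc i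
    1+i-moved = 1+m<n⇒n≢m (subst (suc (suc i) <_) (sym y-1+i≡a) 2+i<a)
    a-avoids : Avoids i d a
    a-avoids = Avoids-above 1+i<a (<-trans (<-trans (n<1+n d) (n<1+n i)) 1+i<a)
    T₀-unpivoted : Unpivoted i (Conj.T₀ 1+i-moved)
    T₀-unpivoted =
      let L₁ , L₂ , L₃ , decomposition , g₁ , g₂ , g₃ =
            Conj.two-openers 1+i-moved y-1+i≡a 1+i<a (1≤d , <⇒≤ (<-≤-trans d<b b≤n)) yd≡b d<b a<b
      in subst (Unpivoted i ∘ foldl rBS []) (sym decomposition)
           (Case6.after-pairs d a-avoids (>⇒≢ (<-trans (<-trans (n<1+n i) 1+i<a) a<b))
              L₁ L₂ L₃ g₁ g₂ g₃)

proposition4p12 : (n : ℕ) (y z : Fin n → Fin n) (i : ℕ) →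
    IsInvolution y → IsInvolution z →
    1 ≤ i → i < n →
    (∀ k → 1 ≤ k → k ≤ n → app z k ≡ swap i (app y (swap i k))) →
    app y i ≡ i →
    ((∃₂ λ a b → HasCycle y a (i + 1) × HasCycle y b (i + 2) × a < b × b < i)
     ⊎ (∃₂ λ a b → HasCycle y a (i + 1) × HasCycle y (i + 2) b × a < i × i + 2 < b)
     ⊎ (∃₂ λ a b → HasCycle y (i + 1) a × HasCycle y (i + 2) b × i + 2 < a × a < b)
     ⊎ (∃₂ λ a b → HasCycle y b (i ∸ 1) × HasCycle y a (i + 1) × a < b × b < i)
     ⊎ (∃₂ λ a b → HasCycle y a (i + 1) × HasCycle y (i ∸ 1) b × a < i × i + 2 < b)
     ⊎ (∃₂ λ a b → HasCycle y (i + 1) a × HasCycle y (i ∸ 1) b × i + 2 < a × a < b)) →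
    λm y ≡ λm z
proposition4p12 n y z zero    _     _ () _   _      _
proposition4p12 n y z (suc d) y-inv _ _  i<n z-conj y-i =
  [ (λ (_ , _ , c , _) → closing c) ,
  [ (λ (_ , _ , c , _) → closing c) ,
  [ (λ (_ , _ , c₁ , c₂ , p , q) → opening-with-2+i c₁ c₂ p q) ,
  [ (λ (_ , _ , _ , c , _) → closing c) ,
  [ (λ (_ , _ , c , _) → closing c) ,
    (λ (_ , _ , c₁ , c₂ , p , q) → opening-with-i-1 c₁ c₂ p q) ]′ ]′ ]′ ]′ ]′
  where open Cases y z d y-inv i<n z-conj y-i
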